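{- Let $\delta$ be either $\delta^{\mathcal{T}}_{\square}$ or $\delta^{\mathcal{T}}_{2}$ (the tree distances of graphs defined in the context). For every tree $T$ and every $\epsilon > 0$ there is an $\eta > 0$ such that, for all graphs $G$ and $H$, if $\delta(G,H) \le \eta$, then $\lvert t(T,G) - t(T,H) \rvert \le \epsilon$.
   Context: Graphs are finite, simple, undirected. For graphs $F,G$, $\hom(F,G)$ is the number of maps $\varphi\colon V(F)\to V(G)$ with $\varphi(u)\varphi(v)\in E(G)$ for all $uv\in E(F)$, and the homomorphism density is $t(F,G)=\hom(F,G)/|V(G)|^{|V(F)|}$. Write $\mathsf{v}(G)=|V(G)|$. A fractional overlay of graphs $G,H$ is a matrix $X\in\mathbb{R}^{V(G)\times V(H)}$ with $X_{uv}\ge 0$, $\sum_{v\in V(H)}X_{uv}=1/\mathsf{v}(G)$ for all $u\in V(G)$ and $\sum_{u\in V(G)}X_{uv}=1/\mathsf{v}(H)$ for all $v\in V(H)$; $\mathcal{X}(G,H)$ is the set of these. The cut norm of a matrix $M\in\mathbb{R}^{m\times n}$ is $\|M\|_\square=\max_{S\subseteq[m],T\subseteq[n]}\lvert\sum_{i\in S,j\in T}M_{ij}\rvert$ and $\|M\|_2$ denotes its spectral (operator $\ell_2$) norm. With $A,B$ the adjacency matrices of $G,H$: $\delta^{\mathcal{T}}_{\square}(G,H)=\inf_{X\in\mathcal{X}(G,H)}\frac{1}{\mathsf{v}(G)\mathsf{v}(H)}\|\mathsf{v}(H)\,AX-\mathsf{v}(G)\,XB\|_\square$ and $\delta^{\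mathcal{T}}_{2}(G,H)=\inf_{X\in\mathcal{X}(G,H)}\frac{1}{\sqrt{\mathsf{v}(G)\mathsf{v}(H)}}\|\mathsf{v}(H)\,AX-\mathsf{v}(G)\,XB\|_2$.
   Formalization: The parameters ε and η are rational, and in δ(G,H) ≤ η the fractional overlays have rational entries and the spectral norm is tested on rational vectors. -}

module Defs where

open import Data.Bool using (Bool; true; false; if_then_else_; _∧_; _∨_; not)
open import Data.Nat as ℕ using (ℕ; zero; suc)
open import Data.Fin using (Fin; zero; suc; inject₁; fromℕ)
open import Data.List using (List; []; _∷_; map; concatMap; length; filterᵇ; allFin)
open import Data.Integer using (+_)
open import Data.Rational using (ℚ; 0ℚ; 1ℚ; _+_; _*_; _-_; _/_; ∣_∣; _≤_; _<_)
open import Data.Product using (Σ; _×_)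
open import Relation.Binary.PropositionalEquality using (_≡_)
open import Relation.Nullary using (¬_)
open import Function.Definitions using (Injective)

record Graph : Set where
  field
    pn    : ℕ
    adj   : Fin (suc pn) → Fin (suc pn) → Bool
    sym   : ∀ u w → adj u w ≡ adj w u
    irrefl : ∀ u → adj u u ≡ false
open Graph public

v : Graph → ℕ
v G = suc (pn G)

V : Graph → Set
V G = Fin (v G)

data Walk (G : Graph) : V G → V G → Set where
  here : ∀ {u} → Walk G u u
  step : ∀ {u w x} → adj G u w ≡ true → Walk G w x → Walk G u x

Connected : Graph → Set
Connected G = ∀ u w → Walk G u w

-- a cycle of length k+3: injective c with c i ~ c (i+1) and c last ~ c 0
IsCycle : (G : Graph) (k : ℕ) → (Fin (suc (suc (suc k))) → V G) → Set
IsCycle G k c =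
  Injective _≡_ _≡_ c
  × (∀ (i : Fin (suc (suc k))) → adj G (c (inject₁ i)) (c (suc i)) ≡ true)
  × (adj G (c (fromℕ (suc (suc k)))) (c zero) ≡ true)

Acyclic : Graph → Set
Acyclic G = ∀ k (c : Fin (suc (suc (suc k))) → V G) → ¬ IsCycle G k c

IsTree : Graph → Set
IsTree G = Connected G × Acyclic G

allFinᵇ : ∀ n → (Fin n → Bool) → Bool
allFinᵇ zero    p = true
allFinᵇ (suc n) p = p zero ∧ allFinᵇ n (λ i → p (suc i))

consF : ∀ {m n} → Fin n → (Fin m → Fin n) → Fin (suc m) → Fin n
consF i f zero    = i
consF i f (suc j) = f j

allMaps : ∀ m n → List (Fin m → Fin n)
allMaps zero    n = (λ ()) ∷ []
allMaps (suc m) n = concatMap (λ f → map (λ i → consF i f) (allFin n)) (allMaps m n)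

isHomᵇ : (F G : Graph) → (V F → V G) → Bool
isHomᵇ F G φ = allFinᵇ (v F) λ a → allFinᵇ (v F) λ b →
  not (adj F a b) ∨ adj G (φ a) (φ b)

hom : Graph → Graph → ℕ
hom F G = length (filterᵇ (isHomᵇ F G) (allMaps (v F) (v G)))

fromℕℚ : ℕ → ℚ
fromℕℚ n = + n / 1

_^ℚ_ : ℚ → ℕ → ℚ
q ^ℚ zero  = 1ℚ
q ^ℚ suc n = q * (q ^ℚ n)

inv : Graph → ℚ
inv G = + 1 / v G

t : Graph → Graph → ℚ
t F G = fromℕℚ (hom F G) * (inv G ^ℚ v F)

Σ[_] : ∀ n → (Fin n → ℚ) → ℚ
Σ[ zero ]  f = 0ℚ
Σ[ suc n ] f = f zero + Σ[ n ] (λ i → f (suc i))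

Mat : ℕ → ℕ → Set
Mat a b = Fin a → Fin b → ℚ

_·ᴹ_ : ∀ {a b c} → Mat a b → Mat b c → Mat a c
_·ᴹ_ {b = b} M N i j = Σ[ b ] (λ k → M i k * N k j)

adjMat : (G : Graph) → Mat (v G) (v G)
adjMat G u w = if adj G u w then 1ℚ else 0ℚ

IsOverlay : (G H : Graph) → Mat (v G) (v H) → Set
IsOverlay G H X =
  (∀ u w → 0ℚ ≤ X u w)
  × (∀ u → Σ[ v H ] (λ w → X u w) ≡ inv G)
  × (∀ w → Σ[ v G ] (λ u → X u w) ≡ inv H)

diffMat : (G H : Graph) → Mat (v G) (v H) → Mat (v G) (v H)
diffMat G H X u w =
  fromℕℚ (v H) * (adjMat G ·ᴹ X) u w - fromℕℚ (v G) * (X ·ᴹ adjMat H) u w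

-- ‖M‖_□ ≤ c  (cut norm is a max over S ⊆ rows, T ⊆ cols)
CutNormLe : ∀ {a b} → Mat a b → ℚ → Set
CutNormLe {a} {b} M c = ∀ (S : Fin a → Bool) (T : Fin b → Bool) →
  ∣ Σ[ a ] (λ i → Σ[ b ] (λ j → if S i ∧ T j then M i j else 0ℚ)) ∣ ≤ c

-- ‖M‖_2 ≤ c, stated with c² =: c2 (c ≥ 0):  ‖Mx‖² ≤ c² ‖x‖² for all x
sqNorm : ∀ n → (Fin n → ℚ) → ℚ
sqNorm n x = Σ[ n ] (λ i → x i * x i)

SpecNormSqLe : ∀ {a b} → Mat a b → ℚ → Set
SpecNormSqLe {a} {b} M c2 = ∀ (x : Fin b → ℚ) →
  sqNorm a (λ i → Σ[ b ] (λ j → M i j * x j)) ≤ c2 * sqNorm b x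

data Dist : Set where
  cutDist specDist : Dist

-- "δ(G,H) ≤ η": the infimum over overlays is ≤ η, i.e. for every η' > η
-- some overlay X achieves the normalised norm ≤ η'.
NormOK : Dist → (G H : Graph) → Mat (v G) (v H) → ℚ → Set
NormOK cutDist  G H X η' =
  CutNormLe (diffMat G H X) (η' * fromℕℚ (v G) * fromℕℚ (v H))
NormOK specDist G H X η' =
  SpecNormSqLe (diffMat G H X) (η' * η' * fromℕℚ (v G) * fromℕℚ (v H))

DistLe : Dist → Graph → Graph → ℚ → Set
DistLe d G H η = ∀ η' → η < η' →
  Σ (Mat (v G) (v H)) λ X → IsOverlay G H X × NormOK d G H X η'

-- The statement is strengthened to weighted densities
-- tʷ T G g = v(G)^(-v(T)) Σ_{φ hom} Π_i g_i(φ i) with vertex weights g_i : V(G) → [0,1], and proved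
-- by removing a leaf at a time: deleting a leaf ℓ with parent p gives tʷ T G g = tʷ (T - ℓ) G g′,
-- where g′ multiplies g_p by the neighbourhood average a = A g_ℓ / v(G).
-- A fractional overlay X is a coupling of the uniform distributions on V(G) and V(H), and weights
-- g on G and h on H are compared through their transport cost 𝔼_X ∣g(u) - h(w)∣.  If the cut norm
-- of v(H) A X - v(G) X B is at most e v(G) v(H), then expanding 𝔼_X (a(u) - b(w))², where
-- b = B h / v(H), and bounding the cross term 𝔼_X a(u) b(w) from below through the cut norm (once
-- for X and once for its transpose) gives cost(a, b)² ≤ 2 (cost(g, h) + e).  As costs of products
-- of [0,1]-weights add up, one leaf removal turns δ-close weights into O(√δ)-close ones, and for a
-- single vertex the difference of the densities is at most the cost.  The spectral distance
-- bounds the cut distance by Cauchy–Schwarz.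

module Submission where

open import Data.Bool using (Bool; true; false; if_then_else_; _∧_; _∨_; not) renaming (_≟_ to _≟ᵇ_)
open import Data.Bool.Properties using (∧-conicalˡ; ∧-conicalʳ; ∧-identityʳ; ∧-zeroʳ; ⇔→≡)
open import Data.Empty using (⊥; ⊥-elim)
open import Data.Fin as F using (Fin; zero; suc; inject₁; fromℕ; punchIn; punchOut)
import Data.Fin.Properties as F
open import Data.Integer using (+_)
import Data.Integer as ℤ
import Data.Integer.Tactic.RingSolver as ℤ-Solver
open import Data.List as L using (List; []; _∷_)
open import Data.Nat as ℕ using (ℕ; zero; suc)
import Data.Nat.Properties as ℕ
open import Data.Product using (Σ; _×_; _,_; proj₁; proj₂; ∃)
open import Data.Rational
  using (ℚ; 0ℚ; 1ℚ; _+_; _*_; _-_; -_; ∣_∣; _≤_; _<_; _/_; _⊓_; positive; nonNegative; toℚᵘ)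
open import Data.Rational.Properties
import Data.Rational.Unnormalised as U
import Data.Rational.Unnormalised.Properties as UP
open import Data.Sum using (_⊎_; inj₁; inj₂)
open import Data.Unit using (tt)
open import Function using (_∘_; mk⇔)
open import Function.Definitions using (Injective)
open import Relation.Binary.PropositionalEquality
open import Relation.Nullary using (Dec; yes; no; does)
open import Relation.Nullary.Decidable using (_×-dec_; ¬?; dec⇒maybe)
open import Tactic.RingSolver using (solve-∀)
open import Tactic.RingSolver.Core.AlmostCommutativeRing using (AlmostCommutativeRing; fromCommutativeRing)

open import Defs hiding (sym)

-- Rational arithmetic

ℚ-ring : AlmostCommutativeRing _ _
ℚ-ring = fromCommutativeRing +-*-commutativeRing (λ x → dec⇒maybe (0ℚ ≟ x))

fromℕℚ-suc : ∀ n → fromℕℚ (suc n) ≡ 1ℚ + fromℕℚ n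
fromℕℚ-suc n = toℚᵘ-injective (begin
  toℚᵘ (fromℕℚ (suc n))                      ≈⟨ toℚᵘ-fromℚᵘ (U.mkℚᵘ (+ suc n) 0) ⟩
  U.mkℚᵘ (+ suc n) 0                          ≈⟨ U.*≡* (lemma (+ n)) ⟩
  U.mkℚᵘ (+ 1) 0 U.+ U.mkℚᵘ (+ n) 0          ≈⟨ UP.+-cong (toℚᵘ-fromℚᵘ (U.mkℚᵘ (+ 1) 0))
                                                            (toℚᵘ-fromℚᵘ (U.mkℚᵘ (+ n) 0)) ⟨
  toℚᵘ 1ℚ U.+ toℚᵘ (fromℕℚ n)                ≈⟨ toℚᵘ-homo-+ 1ℚ (fromℕℚ n) ⟨
  toℚᵘ (1ℚ + fromℕℚ n)                        ∎)
  where
  open UP.≃-Reasoning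
  lemma : ∀ x → (+ 1 ℤ.+ x) ℤ.* + 1 ≡ (+ 1 ℤ.* + 1 ℤ.+ x ℤ.* + 1) ℤ.* + 1
  lemma = ℤ-Solver.solve-∀

n*1/n≡1 : ∀ n → fromℕℚ (suc n) * (+ 1 / suc n) ≡ 1ℚ
n*1/n≡1 n = toℚᵘ-injective (begin
  toℚᵘ (fromℕℚ (suc n) * (+ 1 / suc n))          ≈⟨ toℚᵘ-homo-* (fromℕℚ (suc n)) (+ 1 / suc n) ⟩
  toℚᵘ (fromℕℚ (suc n)) U.* toℚᵘ (+ 1 / suc n)   ≈⟨ UP.*-cong (toℚᵘ-fromℚᵘ (U.mkℚᵘ (+ suc n) 0))
                                                               (toℚᵘ-fromℚᵘ (U.mkℚᵘ (+ 1) n)) ⟩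
  U.mkℚᵘ (+ suc n) 0 U.* U.mkℚᵘ (+ 1) n          ≈⟨ U.*≡* (trans (lemma (+ n))
                                                      (cong (λ d → + 1 ℤ.* + suc d)
                                                        (sym (ℕ.+-identityʳ n)))) ⟩
  U.1ℚᵘ                                           ∎)
  where
  open UP.≃-Reasoning
  lemma : ∀ x → ((+ 1 ℤ.+ x) ℤ.* + 1) ℤ.* + 1 ≡ + 1 ℤ.* (+ 1 ℤ.+ x)
  lemma = ℤ-Solver.solve-∀

0≤fromℕℚ : ∀ n → 0ℚ ≤ fromℕℚ n
0≤fromℕℚ n = nonNegative⁻¹ _ {{normalize-nonNeg n 1}}

0<1/suc : ∀ n → 0ℚ < + 1 / suc n
0<1/suc n = positive⁻¹ _ {{normalize-pos 1 (suc n)}}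

0≤inv : ∀ G → 0ℚ ≤ inv G
0≤inv G = <⇒≤ (0<1/suc (pn G))

v*inv≡1 : ∀ G → fromℕℚ (v G) * inv G ≡ 1ℚ
v*inv≡1 G = n*1/n≡1 (pn G)

0≤q-p⇒p≤q : ∀ {p q} → 0ℚ ≤ q - p → p ≤ q
0≤q-p⇒p≤q {p} {q} h = subst₂ _≤_ (+-identityˡ p) (lemma q p) (+-monoˡ-≤ p h)
  where
  lemma : ∀ q p → (q - p) + p ≡ q
  lemma = solve-∀ ℚ-ring

≤-by-difference : ∀ {p q} r → 0ℚ ≤ r → q - p ≡ r → p ≤ q
≤-by-difference r 0≤r q-p≡r = 0≤q-p⇒p≤q (subst (0ℚ ≤_) (sym q-p≡r) 0≤r)

p≤q⇒0≤q-p : ∀ {p q} → p ≤ q → 0ℚ ≤ q - p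
p≤q⇒0≤q-p {p} {q} h = subst (_≤ q - p) (+-inverseʳ p) (+-monoˡ-≤ (- p) h)

0≤p+q : ∀ {p q} → 0ℚ ≤ p → 0ℚ ≤ q → 0ℚ ≤ p + q
0≤p+q {p} {q} hp hq = subst (_≤ p + q) (+-identityˡ 0ℚ) (+-mono-≤ hp hq)

0≤p*q : ∀ {p q} → 0ℚ ≤ p → 0ℚ ≤ q → 0ℚ ≤ p * q
0≤p*q {p} {q} hp hq = nonNegative⁻¹ _ {{nonNeg*nonNeg⇒nonNeg p {{nonNegative hp}} q {{nonNegative hq}}}}

0<p*q : ∀ {p q} → 0ℚ < p → 0ℚ < q → 0ℚ < p * q
0<p*q {p} {q} hp hq = positive⁻¹ _ {{pos*pos⇒pos p {{positive hp}} q {{positive hq}}}}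

*-monoˡ-≤-0≤ : ∀ {r p q} → 0ℚ ≤ r → p ≤ q → r * p ≤ r * q
*-monoˡ-≤-0≤ {r} 0≤r = *-monoˡ-≤-nonNeg r {{nonNegative 0≤r}}

neg-involutive : ∀ p → - - p ≡ p
neg-involutive = solve-∀ ℚ-ring

0<p⊓q : ∀ {p q} → 0ℚ < p → 0ℚ < q → 0ℚ < p ⊓ q
0<p⊓q {p} {q} 0<p 0<q with ⊓-sel p q
... | inj₁ p⊓q≡p = subst (0ℚ <_) (sym p⊓q≡p) 0<p
... | inj₂ p⊓q≡q = subst (0ℚ <_) (sym p⊓q≡q) 0<q

0≤p*p : ∀ p → 0ℚ ≤ p * p
0≤p*p p with ≤-total 0ℚ p
... | inj₁ 0≤p = 0≤p*q 0≤p 0≤p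
... | inj₂ p≤0 = subst (0ℚ ≤_) (lemma p) (0≤p*q (neg-antimono-≤ p≤0) (neg-antimono-≤ p≤0))
  where
  lemma : ∀ p → (- p) * (- p) ≡ p * p
  lemma = solve-∀ ℚ-ring

∣p∣*∣p∣≡p*p : ∀ p → ∣ p ∣ * ∣ p ∣ ≡ p * p
∣p∣*∣p∣≡p*p p = trans (sym (∣p*q∣≡∣p∣*∣q∣ p p)) (0≤p⇒∣p∣≡p (0≤p*p p))

p≤∣p∣ : ∀ p → p ≤ ∣ p ∣
p≤∣p∣ p with ∣p∣≡p∨∣p∣≡-p p
... | inj₁ ∣p∣≡p = ≤-reflexive (sym ∣p∣≡p)
... | inj₂ ∣p∣≡-p = ≤-trans p≤0 (0≤∣p∣ p)
  where
  p≤0 : p ≤ 0ℚ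
  p≤0 = ≤-trans (≤-reflexive (sym (neg-involutive p)))
          (neg-antimono-≤ (subst (0ℚ ≤_) ∣p∣≡-p (0≤∣p∣ p)))

-p≤∣p∣ : ∀ p → - p ≤ ∣ p ∣
-p≤∣p∣ p = subst (- p ≤_) (∣-p∣≡∣p∣ p) (p≤∣p∣ (- p))

∣p∣≤q⇒p≤q : ∀ {p q} → ∣ p ∣ ≤ q → p ≤ q
∣p∣≤q⇒p≤q {p} = ≤-trans (p≤∣p∣ p)

∣p∣≤q⇒-q≤p : ∀ {p q} → ∣ p ∣ ≤ q → - q ≤ p
∣p∣≤q⇒-q≤p {p} {q} h =
  subst (- q ≤_) (neg-involutive p) (neg-antimono-≤ (≤-trans (-p≤∣p∣ p) h))

-q≤p≤q⇒∣p∣≤q : ∀ {p q} → - q ≤ p → p ≤ q → ∣ p ∣ ≤ q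
-q≤p≤q⇒∣p∣≤q {p} {q} lo hi with ∣p∣≡p∨∣p∣≡-p p
... | inj₁ ∣p∣≡p = subst (_≤ q) (sym ∣p∣≡p) hi
... | inj₂ ∣p∣≡-p = subst (_≤ q) (sym ∣p∣≡-p)
  (subst (- p ≤_) (neg-involutive q) (neg-antimono-≤ lo))

∣p-q∣≡∣q-p∣ : ∀ p q → ∣ p - q ∣ ≡ ∣ q - p ∣
∣p-q∣≡∣q-p∣ p q = trans (sym (∣-p∣≡∣p∣ (p - q))) (cong ∣_∣ (lemma p q))
  where
  lemma : ∀ p q → - (p - q) ≡ q - p
  lemma = solve-∀ ℚ-ring

p*p≤q*q⇒p≤q : ∀ {p q} → 0ℚ ≤ p → 0ℚ ≤ q → p * p ≤ q * q → p ≤ q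
p*p≤q*q⇒p≤q {p} {q} 0≤p 0≤q pp≤qq with p ≤? q
... | yes p≤q = p≤q
... | no p≰q = ⊥-elim (<-irrefl refl (<-≤-trans qq<pp pp≤qq))
  where
  q<p : q < p
  q<p = ≰⇒> p≰q
  0<p-q : 0ℚ < p - q
  0<p-q = subst (_< p - q) (+-inverseʳ q) (+-monoˡ-< (- q) q<p)
  0<p+q : 0ℚ < p + q
  0<p+q = ≤-<-trans (0≤p+q 0≤q 0≤q) (+-monoˡ-< q q<p)
  lemma : ∀ p q → (p - q) * (p + q) + q * q ≡ p * p
  lemma = solve-∀ ℚ-ring
  qq<pp : q * q < p * p
  qq<pp = subst₂ _<_ (+-identityˡ (q * q)) (lemma p q) (+-monoˡ-< (q * q) (0<p*q 0<p-q 0<p+q))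

InUnit : ℚ → Set
InUnit p = 0ℚ ≤ p × p ≤ 1ℚ

UnitValued : ∀ {A : Set} → (A → ℚ) → Set
UnitValued f = ∀ x → InUnit (f x)

InUnit-1 : InUnit 1ℚ
InUnit-1 = ≤ᵇ⇒≤ tt , ≤-refl

InUnit-* : ∀ {p q} → InUnit p → InUnit q → InUnit (p * q)
InUnit-* {p} {q} (0≤p , p≤1) (0≤q , q≤1) =
  0≤p*q 0≤p 0≤q ,
  ≤-by-difference ((1ℚ - p) + p * (1ℚ - q))
    (0≤p+q (p≤q⇒0≤q-p p≤1) (0≤p*q 0≤p (p≤q⇒0≤q-p q≤1))) (lemma p q)
  where
  lemma : ∀ p q → 1ℚ - p * q ≡ (1ℚ - p) + p * (1ℚ - q)
  lemma = solve-∀ ℚ-ring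

∣r*p∣≤∣p∣ : ∀ {r} p → InUnit r → ∣ r * p ∣ ≤ ∣ p ∣
∣r*p∣≤∣p∣ {r} p (0≤r , r≤1) rewrite ∣p*q∣≡∣p∣*∣q∣ r p | 0≤p⇒∣p∣≡p 0≤r =
  ≤-by-difference ((1ℚ - r) * ∣ p ∣) (0≤p*q (p≤q⇒0≤q-p r≤1) (0≤∣p∣ p)) (lemma r ∣ p ∣)
  where
  lemma : ∀ r a → a - r * a ≡ (1ℚ - r) * a
  lemma = solve-∀ ℚ-ring

-- Finite sums, products and means

Σ-cong : ∀ n {f g : Fin n → ℚ} → (∀ i → f i ≡ g i) → Σ[ n ] f ≡ Σ[ n ] g
Σ-cong zero    f≡g = refl
Σ-cong (suc n) f≡g = cong₂ _+_ (f≡g zero) (Σ-cong n (λ i → f≡g (suc i)))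

Σ-zero : ∀ n → Σ[ n ] (λ _ → 0ℚ) ≡ 0ℚ
Σ-zero zero    = refl
Σ-zero (suc n) = trans (+-identityˡ _) (Σ-zero n)

Σ-+ : ∀ n (f g : Fin n → ℚ) → Σ[ n ] (λ i → f i + g i) ≡ Σ[ n ] f + Σ[ n ] g
Σ-+ zero    f g = refl
Σ-+ (suc n) f g = trans (cong (_+_ (f zero + g zero)) (Σ-+ n (λ i → f (suc i)) (λ i → g (suc i))))
  (lemma (f zero) (g zero) _ _)
  where
  lemma : ∀ a b c d → (a + b) + (c + d) ≡ (a + c) + (b + d)
  lemma = solve-∀ ℚ-ring

Σ-*ˡ : ∀ n c (f : Fin n → ℚ) → Σ[ n ] (λ i → c * f i) ≡ c * Σ[ n ] f
Σ-*ˡ zero    c f = sym (*-zeroʳ c)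
Σ-*ˡ (suc n) c f = trans (cong (_+_ (c * f zero)) (Σ-*ˡ n c (λ i → f (suc i))))
  (sym (*-distribˡ-+ c (f zero) _))

Σ-*ʳ : ∀ n c (f : Fin n → ℚ) → Σ[ n ] (λ i → f i * c) ≡ Σ[ n ] f * c
Σ-*ʳ n c f = trans (Σ-cong n (λ i → *-comm (f i) c)) (trans (Σ-*ˡ n c f) (*-comm c _))

Σ-neg : ∀ n (f : Fin n → ℚ) → Σ[ n ] (λ i → - f i) ≡ - Σ[ n ] f
Σ-neg zero    f = refl
Σ-neg (suc n) f = trans (cong (_+_ (- f zero)) (Σ-neg n (λ i → f (suc i))))
  (sym (neg-distrib-+ (f zero) _))

Σ-- : ∀ n (f g : Fin n → ℚ) → Σ[ n ] (λ i → f i - g i) ≡ Σ[ n ] f - Σ[ n ] g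
Σ-- n f g = trans (Σ-+ n f (λ i → - g i)) (cong (_+_ (Σ[ n ] f)) (Σ-neg n g))

Σ-swap : ∀ n m (f : Fin n → Fin m → ℚ) →
  Σ[ n ] (λ i → Σ[ m ] (f i)) ≡ Σ[ m ] (λ j → Σ[ n ] (λ i → f i j))
Σ-swap zero    m f = sym (Σ-zero m)
Σ-swap (suc n) m f = trans (cong (_+_ (Σ[ m ] (f zero))) (Σ-swap n m (λ i → f (suc i))))
  (sym (Σ-+ m (f zero) (λ j → Σ[ n ] (λ i → f (suc i) j))))

Σ-const : ∀ n c → Σ[ n ] (λ _ → c) ≡ fromℕℚ n * c
Σ-const zero    c = sym (*-zeroˡ c)
Σ-const (suc n) c = begin
  c + Σ[ n ] (λ _ → c)      ≡⟨ cong (_+_ c) (Σ-const n c) ⟩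
  c + fromℕℚ n * c          ≡⟨ lemma c (fromℕℚ n) ⟩
  (1ℚ + fromℕℚ n) * c       ≡⟨ cong (_* c) (fromℕℚ-suc n) ⟨
  fromℕℚ (suc n) * c        ∎
  where
  open ≡-Reasoning
  lemma : ∀ c x → c + x * c ≡ (1ℚ + x) * c
  lemma = solve-∀ ℚ-ring

Σ-mono : ∀ n {f g : Fin n → ℚ} → (∀ i → f i ≤ g i) → Σ[ n ] f ≤ Σ[ n ] g
Σ-mono zero    f≤g = ≤-refl
Σ-mono (suc n) f≤g = +-mono-≤ (f≤g zero) (Σ-mono n (λ i → f≤g (suc i)))

Σ-nonNeg : ∀ n {f : Fin n → ℚ} → (∀ i → 0ℚ ≤ f i) → 0ℚ ≤ Σ[ n ] f
Σ-nonNeg n {f} 0≤f = subst (_≤ Σ[ n ] f) (Σ-zero n) (Σ-mono n 0≤f)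

∣Σ∣≤Σ∣∣ : ∀ n (f : Fin n → ℚ) → ∣ Σ[ n ] f ∣ ≤ Σ[ n ] (λ i → ∣ f i ∣)
∣Σ∣≤Σ∣∣ zero    f = ≤-refl
∣Σ∣≤Σ∣∣ (suc n) f = ≤-trans (∣p+q∣≤∣p∣+∣q∣ (f zero) _)
  (+-monoʳ-≤ ∣ f zero ∣ (∣Σ∣≤Σ∣∣ n (λ i → f (suc i))))

Π[_] : ∀ k → (Fin k → ℚ) → ℚ
Π[ zero ]  f = 1ℚ
Π[ suc k ] f = f zero * Π[ k ] (λ i → f (suc i))

Π-cong : ∀ k {f g : Fin k → ℚ} → (∀ i → f i ≡ g i) → Π[ k ] f ≡ Π[ k ] g
Π-cong zero    f≡g = refl
Π-cong (suc k) f≡g = cong₂ _*_ (f≡g zero) (Π-cong k (λ i → f≡g (suc i)))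

Π-one : ∀ k → Π[ k ] (λ _ → 1ℚ) ≡ 1ℚ
Π-one zero    = refl
Π-one (suc k) = trans (*-identityˡ _) (Π-one k)

Π-* : ∀ k (f g : Fin k → ℚ) → Π[ k ] (λ i → f i * g i) ≡ Π[ k ] f * Π[ k ] g
Π-* zero    f g = refl
Π-* (suc k) f g = trans (cong ((f zero * g zero) *_) (Π-* k (λ i → f (suc i)) (λ i → g (suc i))))
  (lemma (f zero) (g zero) _ _)
  where
  lemma : ∀ a b c d → (a * b) * (c * d) ≡ (a * c) * (b * d)
  lemma = solve-∀ ℚ-ring

Π-punchIn : ∀ k (ℓ : Fin (suc k)) (f : Fin (suc k) → ℚ) →
  Π[ suc k ] f ≡ f ℓ * Π[ k ] (λ j → f (punchIn ℓ j))
Π-punchIn k       zero    f = refl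
Π-punchIn (suc k) (suc ℓ) f = trans (cong (f zero *_) (Π-punchIn k ℓ (λ i → f (suc i))))
  (lemma (f zero) (f (suc ℓ)) _)
  where
  lemma : ∀ a b c → a * (b * c) ≡ b * (a * c)
  lemma = solve-∀ ℚ-ring

atPoint : ∀ {k} → Fin k → ℚ → Fin k → ℚ
atPoint p c j = if does (j F.≟ p) then c else 1ℚ

Π-atPoint : ∀ k (p : Fin k) (c : Fin k → ℚ) → Π[ k ] (λ j → atPoint p (c j) j) ≡ c p
Π-atPoint (suc k) zero    c = trans (cong (c zero *_) (Π-one k)) (*-identityʳ (c zero))
Π-atPoint (suc k) (suc p) c = trans (*-identityˡ _) (Π-atPoint k p (λ j → c (suc j)))

record IsMean {I : Set} (𝔼 : (I → ℚ) → ℚ) : Set where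
  field
    cong-𝔼  : ∀ {f g} → (∀ i → f i ≡ g i) → 𝔼 f ≡ 𝔼 g
    nonNeg  : ∀ {f} → (∀ i → 0ℚ ≤ f i) → 0ℚ ≤ 𝔼 f
    +-homo  : ∀ f g → 𝔼 (λ i → f i + g i) ≡ 𝔼 f + 𝔼 g
    *-homo  : ∀ c f → 𝔼 (λ i → c * f i) ≡ c * 𝔼 f
    1-homo  : 𝔼 (λ _ → 1ℚ) ≡ 1ℚ

  const : ∀ c → 𝔼 (λ _ → c) ≡ c
  const c = begin
    𝔼 (λ _ → c)          ≡⟨ cong-𝔼 (λ _ → sym (*-identityʳ c)) ⟩
    𝔼 (λ _ → c * 1ℚ)     ≡⟨ *-homo c (λ _ → 1ℚ) ⟩
    c * 𝔼 (λ _ → 1ℚ)     ≡⟨ cong (c *_) 1-homo ⟩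
    c * 1ℚ               ≡⟨ *-identityʳ c ⟩
    c                    ∎
    where open ≡-Reasoning

  neg-homo : ∀ f → 𝔼 (λ i → - f i) ≡ - 𝔼 f
  neg-homo f = begin
    𝔼 (λ i → - f i)          ≡⟨ cong-𝔼 (λ i → -p≡-1*p (f i)) ⟩
    𝔼 (λ i → (- 1ℚ) * f i)   ≡⟨ *-homo (- 1ℚ) f ⟩
    (- 1ℚ) * 𝔼 f             ≡⟨ -p≡-1*p (𝔼 f) ⟨
    - 𝔼 f                    ∎
    where
    open ≡-Reasoning
    -p≡-1*p : ∀ p → - p ≡ (- 1ℚ) * p
    -p≡-1*p = solve-∀ ℚ-ring

  minus-homo : ∀ f g → 𝔼 (λ i → f i - g i) ≡ 𝔼 f - 𝔼 g
  minus-homo f g = trans (+-homo f (λ i → - g i)) (cong (_+_ (𝔼 f)) (neg-homo g))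

  mono : ∀ {f g} → (∀ i → f i ≤ g i) → 𝔼 f ≤ 𝔼 g
  mono {f} {g} f≤g =
    0≤q-p⇒p≤q (subst (0ℚ ≤_) (minus-homo g f) (nonNeg (λ i → p≤q⇒0≤q-p (f≤g i))))

  ∣𝔼∣≤𝔼∣∣ : ∀ f → ∣ 𝔼 f ∣ ≤ 𝔼 (λ i → ∣ f i ∣)
  ∣𝔼∣≤𝔼∣∣ f = -q≤p≤q⇒∣p∣≤q
    (subst (_≤ 𝔼 f) (neg-homo (λ i → ∣ f i ∣)) (mono (λ i → ∣p∣≤q⇒-q≤p ≤-refl)))
    (mono (λ i → p≤∣p∣ (f i)))

  -- the variance 𝔼 (f - 𝔼 f)² is nonnegative
  𝔼²≤𝔼-square : ∀ f → 𝔼 f * 𝔼 f ≤ 𝔼 (λ i → f i * f i)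
  𝔼²≤𝔼-square f = ≤-by-difference (𝔼 (λ i → (f i - m) * (f i - m)))
    (nonNeg (λ i → 0≤p*p (f i - m))) (sym variance)
    where
    m = 𝔼 f
    expand : ∀ x m → (x - m) * (x - m) ≡ x * x + (- (m + m) * x + m * m)
    expand = solve-∀ ℚ-ring
    collect : ∀ s m → s + (- (m + m) * m + m * m) ≡ s - m * m
    collect = solve-∀ ℚ-ring
    variance : 𝔼 (λ i → (f i - m) * (f i - m)) ≡ 𝔼 (λ i → f i * f i) - m * m
    variance = begin
      𝔼 (λ i → (f i - m) * (f i - m))
        ≡⟨ cong-𝔼 (λ i → expand (f i) m) ⟩
      𝔼 (λ i → f i * f i + (- (m + m) * f i + m * m))
        ≡⟨ +-homo (λ i → f i * f i) (λ i → - (m + m) * f i + m * m) ⟩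
      𝔼 (λ i → f i * f i) + 𝔼 (λ i → - (m + m) * f i + m * m)
        ≡⟨ cong (_+_ (𝔼 (λ i → f i * f i))) (trans (+-homo (λ i → - (m + m) * f i) (λ _ → m * m))
             (cong₂ _+_ (*-homo (- (m + m)) f) (const (m * m)))) ⟩
      𝔼 (λ i → f i * f i) + (- (m + m) * m + m * m)
        ≡⟨ collect (𝔼 (λ i → f i * f i)) m ⟩
      𝔼 (λ i → f i * f i) - m * m
        ∎
      where open ≡-Reasoning

uniformMean : ∀ n → IsMean {Fin (suc n)} (λ f → (+ 1 / suc n) * Σ[ suc n ] f)
uniformMean n = record
  { cong-𝔼 = λ f≡g → cong (i *_) (Σ-cong (suc n) f≡g)
  ; nonNeg = λ 0≤f → 0≤p*q (<⇒≤ (0<1/suc n)) (Σ-nonNeg (suc n) 0≤f)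
  ; +-homo = λ f g → trans (cong (i *_) (Σ-+ (suc n) f g)) (*-distribˡ-+ i (Σ[ suc n ] f) (Σ[ suc n ] g))
  ; *-homo = λ c f → trans (cong (i *_) (Σ-*ˡ (suc n) c f)) (lemma i c (Σ[ suc n ] f))
  ; 1-homo = trans (cong (i *_) (trans (Σ-const (suc n) 1ℚ) (*-identityʳ N))) (trans (*-comm i N) (n*1/n≡1 n))
  }
  where
  i = + 1 / suc n
  N = fromℕℚ (suc n)
  lemma : ∀ i c s → i * (c * s) ≡ c * (i * s)
  lemma = solve-∀ ℚ-ring

Σ²≤n*Σ-squares : ∀ n (z : Fin (suc n) → ℚ) →
  Σ[ suc n ] z * Σ[ suc n ] z ≤ fromℕℚ (suc n) * Σ[ suc n ] (λ i → z i * z i)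
Σ²≤n*Σ-squares n z = begin
  S * S
    ≡⟨ unscale₂ N i S (n*1/n≡1 n) ⟨
  (N * N) * ((i * S) * (i * S))
    ≤⟨ *-monoˡ-≤-0≤ (0≤p*p N) (IsMean.𝔼²≤𝔼-square (uniformMean n) z) ⟩
  (N * N) * (i * Z)
    ≡⟨ unscale₁ N i Z (n*1/n≡1 n) ⟩
  N * Z
    ∎
  where
  open ≤-Reasoning
  N = fromℕℚ (suc n)
  i = + 1 / suc n
  S = Σ[ suc n ] z
  Z = Σ[ suc n ] (λ i → z i * z i)
  unscale₂ : ∀ N i S → N * i ≡ 1ℚ → (N * N) * ((i * S) * (i * S)) ≡ S * S
  unscale₂ N i S Ni≡1 = trans (lemma N i S) (trans (cong (λ x → x * x * (S * S)) Ni≡1) (lemma′ S))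
    where
    lemma : ∀ N i S → (N * N) * ((i * S) * (i * S)) ≡ (N * i) * (N * i) * (S * S)
    lemma = solve-∀ ℚ-ring
    lemma′ : ∀ S → 1ℚ * 1ℚ * (S * S) ≡ S * S
    lemma′ = solve-∀ ℚ-ring
  unscale₁ : ∀ N i Z → N * i ≡ 1ℚ → (N * N) * (i * Z) ≡ N * Z
  unscale₁ N i Z Ni≡1 =
    trans (lemma N i Z) (trans (cong (λ x → N * (x * Z)) Ni≡1) (cong (N *_) (*-identityˡ Z)))
    where
    lemma : ∀ N i Z → (N * N) * (i * Z) ≡ N * ((N * i) * Z)
    lemma = solve-∀ ℚ-ring

-- Homomorphism counts and weighted densities

ΣL : {A : Set} → List A → (A → ℚ) → ℚ
ΣL []       F = 0ℚ
ΣL (x ∷ xs) F = F x + ΣL xs F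

module _ {A : Set} where

  ΣL-cong : (xs : List A) {F G : A → ℚ} → (∀ x → F x ≡ G x) → ΣL xs F ≡ ΣL xs G
  ΣL-cong []       F≡G = refl
  ΣL-cong (x ∷ xs) F≡G = cong₂ _+_ (F≡G x) (ΣL-cong xs F≡G)

  ΣL-*ˡ : (xs : List A) (c : ℚ) (F : A → ℚ) → ΣL xs (λ x → c * F x) ≡ c * ΣL xs F
  ΣL-*ˡ []       c F = sym (*-zeroʳ c)
  ΣL-*ˡ (x ∷ xs) c F = trans (cong (_+_ (c * F x)) (ΣL-*ˡ xs c F)) (sym (*-distribˡ-+ c (F x) _))

  ΣL-++ : (xs ys : List A) (F : A → ℚ) → ΣL (xs L.++ ys) F ≡ ΣL xs F + ΣL ys F
  ΣL-++ []       ys F = sym (+-identityˡ _)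
  ΣL-++ (x ∷ xs) ys F = trans (cong (_+_ (F x)) (ΣL-++ xs ys F)) (sym (+-assoc (F x) _ _))

  ΣL-map : {B : Set} (f : B → A) (xs : List B) (F : A → ℚ) →
    ΣL (L.map f xs) F ≡ ΣL xs (λ y → F (f y))
  ΣL-map f []       F = refl
  ΣL-map f (x ∷ xs) F = cong (_+_ (F (f x))) (ΣL-map f xs F)

  ΣL-concatMap : {B : Set} (f : B → List A) (xs : List B) (F : A → ℚ) →
    ΣL (L.concatMap f xs) F ≡ ΣL xs (λ y → ΣL (f y) F)
  ΣL-concatMap f []       F = refl
  ΣL-concatMap f (x ∷ xs) F =
    trans (ΣL-++ (f x) (L.concatMap f xs) F) (cong (_+_ (ΣL (f x) F)) (ΣL-concatMap f xs F))

ΣL-tabulate : ∀ n {A : Set} (g : Fin n → A) (F : A → ℚ) →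
  ΣL (L.tabulate g) F ≡ Σ[ n ] (λ i → F (g i))
ΣL-tabulate zero    g F = refl
ΣL-tabulate (suc n) g F = cong (_+_ (F (g zero))) (ΣL-tabulate n (λ i → g (suc i)) F)

𝟙 : Bool → ℚ
𝟙 b = if b then 1ℚ else 0ℚ

𝟙-∧ : ∀ a b → 𝟙 (a ∧ b) ≡ 𝟙 a * 𝟙 b
𝟙-∧ true  b = sym (*-identityˡ (𝟙 b))
𝟙-∧ false b = sym (*-zeroˡ (𝟙 b))

InUnit-𝟙 : ∀ b → InUnit (𝟙 b)
InUnit-𝟙 true  = InUnit-1
InUnit-𝟙 false = ≤-refl , ≤ᵇ⇒≤ tt

count≡ΣL𝟙 : {A : Set} (p : A → Bool) (xs : List A) →
  fromℕℚ (L.length (L.filterᵇ p xs)) ≡ ΣL xs (λ x → 𝟙 (p x))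
count≡ΣL𝟙 p []       = refl
count≡ΣL𝟙 p (x ∷ xs) with p x
... | true  = trans (fromℕℚ-suc (L.length (L.filterᵇ p xs))) (cong (_+_ 1ℚ) (count≡ΣL𝟙 p xs))
... | false = trans (count≡ΣL𝟙 p xs) (sym (+-identityˡ _))

Σ-maps : ∀ k n → ((Fin k → Fin n) → ℚ) → ℚ
Σ-maps k n = ΣL (allMaps k n)

Σ-maps-suc : ∀ k n F → Σ-maps (suc k) n F ≡ Σ-maps k n (λ f → Σ[ n ] (λ i → F (consF i f)))
Σ-maps-suc k n F = trans (ΣL-concatMap _ (allMaps k n) F) (ΣL-cong (allMaps k n) (λ f →
  trans (ΣL-map (λ i → consF i f) (L.allFin n) F) (ΣL-tabulate n (λ i → i) (λ i → F (consF i f)))))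

-- Unlike Data.Vec.Functional.insertAt, insert zero a φ is definitionally consF a φ.
insert : ∀ {k n} → Fin (suc k) → Fin n → (Fin k → Fin n) → Fin (suc k) → Fin n
insert zero             a φ = consF a φ
insert {suc k} (suc ℓ) a φ = consF (φ zero) (insert ℓ a (λ j → φ (suc j)))

insert-lookup : ∀ {k n} (ℓ : Fin (suc k)) (a : Fin n) φ → insert ℓ a φ ℓ ≡ a
insert-lookup zero             a φ = refl
insert-lookup {suc k} (suc ℓ) a φ = insert-lookup ℓ a (λ j → φ (suc j))

insert-punchIn : ∀ {k n} (ℓ : Fin (suc k)) (a : Fin n) φ j → insert ℓ a φ (punchIn ℓ j) ≡ φ j
insert-punchIn zero             a φ j       = refl
insert-punchIn {suc k} (suc ℓ) a φ zero    = refl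
insert-punchIn {suc k} (suc ℓ) a φ (suc j) = insert-punchIn ℓ a (λ j → φ (suc j)) j

Σ-maps-insert : ∀ k n (ℓ : Fin (suc k)) F →
  Σ-maps (suc k) n F ≡ Σ-maps k n (λ φ → Σ[ n ] (λ a → F (insert ℓ a φ)))
Σ-maps-insert k       n zero    F = Σ-maps-suc k n F
Σ-maps-insert (suc k) n (suc ℓ) F = begin
  Σ-maps (suc (suc k)) n F
    ≡⟨ Σ-maps-suc (suc k) n F ⟩
  Σ-maps (suc k) n (λ ψ → Σ[ n ] (λ c → F (consF c ψ)))
    ≡⟨ Σ-maps-insert k n ℓ (λ ψ → Σ[ n ] (λ c → F (consF c ψ))) ⟩
  Σ-maps k n (λ φ → Σ[ n ] (λ a → Σ[ n ] (λ c → F (consF c (insert ℓ a φ)))))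
    ≡⟨ ΣL-cong (allMaps k n) (λ φ → Σ-swap n n (λ a c → F (consF c (insert ℓ a φ)))) ⟩
  Σ-maps k n (λ φ → Σ[ n ] (λ c → Σ[ n ] (λ a → F (insert (suc ℓ) a (consF c φ)))))
    ≡⟨ Σ-maps-suc k n (λ φ → Σ[ n ] (λ a → F (insert (suc ℓ) a φ))) ⟨
  Σ-maps (suc k) n (λ φ → Σ[ n ] (λ a → F (insert (suc ℓ) a φ)))
    ∎
  where open ≡-Reasoning

IsHom : (F G : Graph) → (V F → V G) → Set
IsHom F G φ = ∀ a b → adj F a b ≡ true → adj G (φ a) (φ b) ≡ true

allFinᵇ-sound : ∀ n (p : Fin n → Bool) → allFinᵇ n p ≡ true → ∀ i → p i ≡ true
allFinᵇ-sound (suc n) p all zero    = ∧-conicalˡ _ _ all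
allFinᵇ-sound (suc n) p all (suc i) = allFinᵇ-sound n (λ j → p (suc j)) (∧-conicalʳ _ _ all) i

allFinᵇ-complete : ∀ n (p : Fin n → Bool) → (∀ i → p i ≡ true) → allFinᵇ n p ≡ true
allFinᵇ-complete zero    p all = refl
allFinᵇ-complete (suc n) p all =
  cong₂ _∧_ (all zero) (allFinᵇ-complete n (λ j → p (suc j)) (λ j → all (suc j)))

isHomᵇ-sound : ∀ F G φ → isHomᵇ F G φ ≡ true → IsHom F G φ
isHomᵇ-sound F G φ hom a b ab = implication (adj F a b) ab
  (allFinᵇ-sound (v F) (edgeOK a) (allFinᵇ-sound (v F) (λ x → allFinᵇ (v F) (edgeOK x)) hom a) b)
  where
  edgeOK : V F → V F → Bool
  edgeOK x y = not (adj F x y) ∨ adj G (φ x) (φ y)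
  implication : ∀ x {y} → x ≡ true → not x ∨ y ≡ true → y ≡ true
  implication true refl x⇒y = x⇒y

isHomᵇ-complete : ∀ F G φ → IsHom F G φ → isHomᵇ F G φ ≡ true
isHomᵇ-complete F G φ hom = allFinᵇ-complete (v F) _ (λ a → allFinᵇ-complete (v F) _ (λ b →
  implication (adj F a b) (hom a b)))
  where
  implication : ∀ x {y} → (x ≡ true → y ≡ true) → not x ∨ y ≡ true
  implication true  x⇒y = x⇒y refl
  implication false x⇒y = refl

tʷ : (T G : Graph) → (V T → V G → ℚ) → ℚ
tʷ T G g =
  (inv G ^ℚ v T) * Σ-maps (v T) (v G) (λ φ → 𝟙 (isHomᵇ T G φ) * Π[ v T ] (λ i → g i (φ i)))

t≡tʷ-1 : ∀ T G → t T G ≡ tʷ T G (λ _ _ → 1ℚ)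
t≡tʷ-1 T G = begin
  fromℕℚ (hom T G) * (inv G ^ℚ v T)
    ≡⟨ *-comm (fromℕℚ (hom T G)) (inv G ^ℚ v T) ⟩
  (inv G ^ℚ v T) * fromℕℚ (hom T G)
    ≡⟨ cong (_*_ (inv G ^ℚ v T)) (count≡ΣL𝟙 (isHomᵇ T G) (allMaps (v T) (v G))) ⟩
  (inv G ^ℚ v T) * Σ-maps (v T) (v G) (λ φ → 𝟙 (isHomᵇ T G φ))
    ≡⟨ cong (_*_ (inv G ^ℚ v T)) (ΣL-cong (allMaps (v T) (v G)) (λ φ →
         trans (sym (*-identityʳ _)) (cong (_*_ (𝟙 (isHomᵇ T G φ))) (sym (Π-one (v T)))))) ⟩
  tʷ T G (λ _ _ → 1ℚ)
    ∎
  where open ≡-Reasoning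

adjMean : (G : Graph) → (V G → ℚ) → V G → ℚ
adjMean G f z = inv G * Σ[ v G ] (λ y → adjMat G z y * f y)

v*adjMean : ∀ G f z → fromℕℚ (v G) * adjMean G f z ≡ Σ[ v G ] (λ y → adjMat G z y * f y)
v*adjMean G f z =
  trans (sym (*-assoc (fromℕℚ (v G)) (inv G) S)) (trans (cong (_* S) (v*inv≡1 G)) (*-identityˡ S))
  where S = Σ[ v G ] (λ y → adjMat G z y * f y)

InUnit-adjMat : ∀ G u w → InUnit (adjMat G u w)
InUnit-adjMat G u w = InUnit-𝟙 (adj G u w)

adjMean-unit : ∀ G {f : V G → ℚ} → UnitValued f → UnitValued (adjMean G f)
adjMean-unit G {f} f∈[0,1] u =
  0≤p*q (0≤inv G) (Σ-nonNeg (v G) (λ y → proj₁ (InUnit-* (InUnit-adjMat G u y) (f∈[0,1] y)))) ,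
  (begin
    inv G * Σ[ v G ] (λ y → adjMat G u y * f y)
      ≤⟨ *-monoˡ-≤-0≤ (0≤inv G)
           (Σ-mono (v G) (λ y → proj₂ (InUnit-* (InUnit-adjMat G u y) (f∈[0,1] y)))) ⟩
    inv G * Σ[ v G ] (λ _ → 1ℚ)
      ≡⟨ cong (inv G *_) (trans (Σ-const (v G) 1ℚ) (*-identityʳ (fromℕℚ (v G)))) ⟩
    inv G * fromℕℚ (v G)
      ≡⟨ trans (*-comm (inv G) (fromℕℚ (v G))) (v*inv≡1 G) ⟩
    1ℚ
      ∎)
  where open ≤-Reasoning

-- Removing a leaf

graphOn : ∀ k (a : Fin (suc k) → Fin (suc k) → Bool) →
  (∀ x y → a x y ≡ a y x) → (∀ x → a x x ≡ false) → Graph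
graphOn k a s ir = record { pn = k ; adj = a ; sym = s ; irrefl = ir }

record LeafOf (G : Graph) : Set where
  field
    leaf parent : V G
    leaf~parent : adj G leaf parent ≡ true
    only-parent : ∀ x → adj G leaf x ≡ true → x ≡ parent

module LeafRemoval {k} (a : Fin (suc (suc k)) → Fin (suc (suc k)) → Bool)
  (a-sym : ∀ x y → a x y ≡ a y x) (a-irrefl : ∀ x → a x x ≡ false)
  (L : LeafOf (graphOn (suc k) a a-sym a-irrefl)) where

  open LeafOf L

  T : Graph
  T = graphOn (suc k) a a-sym a-irrefl

  T⁻ : Graph
  T⁻ = graphOn k (λ x y → a (punchIn leaf x) (punchIn leaf y))
    (λ x y → a-sym (punchIn leaf x) (punchIn leaf y)) (λ x → a-irrefl (punchIn leaf x))

  view : ∀ x → x ≡ leaf ⊎ Σ (V T⁻) (λ x⁻ → punchIn leaf x⁻ ≡ x)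
  view x with x F.≟ leaf
  ... | yes x≡leaf = inj₁ x≡leaf
  ... | no  x≢leaf = inj₂ (punchOut (x≢leaf ∘ sym) , F.punchIn-punchOut (x≢leaf ∘ sym))

  leaf≢parent : leaf ≢ parent
  leaf≢parent leaf≡parent
    with trans (sym leaf~parent) (trans (cong (a leaf) (sym leaf≡parent)) (a-irrefl leaf))
  ... | ()

  parent⁻ : V T⁻
  parent⁻ = punchOut leaf≢parent

  punchIn-parent⁻ : punchIn leaf parent⁻ ≡ parent
  punchIn-parent⁻ = F.punchIn-punchOut leaf≢parent

  ~leaf⇒parent : ∀ x → a x leaf ≡ true → x ≡ parent
  ~leaf⇒parent x x~leaf = only-parent x (trans (a-sym leaf x) x~leaf)

  module _ (G : Graph) (φ : V T⁻ → V G) (c : V G) where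

    insert-parent : insert leaf c φ parent ≡ φ parent⁻
    insert-parent = trans (cong (insert leaf c φ) (sym punchIn-parent⁻)) (insert-punchIn leaf c φ parent⁻)

    homᵇ-insert : isHomᵇ T G (insert leaf c φ) ≡ isHomᵇ T⁻ G φ ∧ adj G (φ parent⁻) c
    homᵇ-insert = ⇔→≡ (mk⇔ restrict extend)
      where
      ψ = insert leaf c φ
      restrict : isHomᵇ T G ψ ≡ true → isHomᵇ T⁻ G φ ∧ adj G (φ parent⁻) c ≡ true
      restrict ψ-homᵇ = cong₂ _∧_ (isHomᵇ-complete T⁻ G φ φ-hom) parent~c
        where
        ψ-hom = isHomᵇ-sound T G ψ ψ-homᵇ
        φ-hom : IsHom T⁻ G φ
        φ-hom x y x~y = subst₂ (λ z w → adj G z w ≡ true)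
          (insert-punchIn leaf c φ x) (insert-punchIn leaf c φ y) (ψ-hom _ _ x~y)
        parent~c : adj G (φ parent⁻) c ≡ true
        parent~c = trans (Graph.sym G (φ parent⁻) c) (subst₂ (λ z w → adj G z w ≡ true)
          (insert-lookup leaf c φ) insert-parent (ψ-hom leaf parent leaf~parent))
      extend : isHomᵇ T⁻ G φ ∧ adj G (φ parent⁻) c ≡ true → isHomᵇ T G ψ ≡ true
      extend both = isHomᵇ-complete T G ψ ψ-hom
        where
        φ-hom = isHomᵇ-sound T⁻ G φ (∧-conicalˡ _ _ both)
        parent~c = ∧-conicalʳ _ _ both
        ψ-hom : IsHom T G ψ
        ψ-hom x y x~y with view x | view y
        ... | inj₁ refl | _ rewrite only-parent y x~y | insert-lookup leaf c φ | insert-parent =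
          trans (Graph.sym G c (φ parent⁻)) parent~c
        ... | inj₂ _ | inj₁ refl
          rewrite ~leaf⇒parent x x~y | insert-lookup leaf c φ | insert-parent = parent~c
        ... | inj₂ (x⁻ , refl) | inj₂ (y⁻ , refl)
          rewrite insert-punchIn leaf c φ x⁻ | insert-punchIn leaf c φ y⁻ = φ-hom x⁻ y⁻ x~y

  absorb : (G : Graph) → (V T → V G → ℚ) → V T⁻ → V G → ℚ
  absorb G g j z = g (punchIn leaf j) z * atPoint parent⁻ (adjMean G (g leaf) z) j

  module _ (G : Graph) (g : V T → V G → ℚ) where

    summand : (V T → V G) → ℚ
    summand ψ = 𝟙 (isHomᵇ T G ψ) * Π[ v T ] (λ i → g i (ψ i))

    summand⁻ : (V T⁻ → V G) → ℚ
    summand⁻ φ = 𝟙 (isHomᵇ T⁻ G φ) * Π[ v T⁻ ] (λ j → absorb G g j (φ j))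

    Σ-summand-insert : ∀ φ →
      Σ[ v G ] (λ c → summand (insert leaf c φ)) ≡ fromℕℚ (v G) * summand⁻ φ
    Σ-summand-insert φ = begin
      Σ[ v G ] (λ c → summand (insert leaf c φ))
        ≡⟨ Σ-cong (v G) split-summand ⟩
      Σ[ v G ] (λ c → (h * P) * (adjMat G (φ parent⁻) c * g leaf c))
        ≡⟨ Σ-*ˡ (v G) (h * P) (λ c → adjMat G (φ parent⁻) c * g leaf c) ⟩
      (h * P) * Σ[ v G ] (λ c → adjMat G (φ parent⁻) c * g leaf c)
        ≡⟨ cong (_*_ (h * P)) (sym (v*adjMean G (g leaf) (φ parent⁻))) ⟩
      (h * P) * (fromℕℚ (v G) * adjMean G (g leaf) (φ parent⁻))
        ≡⟨ lemma h P (fromℕℚ (v G)) (adjMean G (g leaf) (φ parent⁻)) ⟩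
      fromℕℚ (v G) * (h * (P * adjMean G (g leaf) (φ parent⁻)))
        ≡⟨ cong (λ x → fromℕℚ (v G) * (h * x)) (sym Π-absorb) ⟩
      fromℕℚ (v G) * summand⁻ φ
        ∎
      where
      open ≡-Reasoning
      h = 𝟙 (isHomᵇ T⁻ G φ)
      P = Π[ v T⁻ ] (λ j → g (punchIn leaf j) (φ j))
      lemma : ∀ h P n m → (h * P) * (n * m) ≡ n * (h * (P * m))
      lemma = solve-∀ ℚ-ring
      Π-absorb : Π[ v T⁻ ] (λ j → absorb G g j (φ j)) ≡ P * adjMean G (g leaf) (φ parent⁻)
      Π-absorb = trans
        (Π-* (v T⁻) (λ j → g (punchIn leaf j) (φ j)) (λ j → atPoint parent⁻ (adjMean G (g leaf) (φ j)) j))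
        (cong (_*_ P) (Π-atPoint (v T⁻) parent⁻ (λ j → adjMean G (g leaf) (φ j))))
      split-summand : ∀ c → summand (insert leaf c φ) ≡ (h * P) * (adjMat G (φ parent⁻) c * g leaf c)
      split-summand c = begin
        𝟙 (isHomᵇ T G (insert leaf c φ)) * Π[ v T ] (λ i → g i (insert leaf c φ i))
          ≡⟨ cong₂ _*_ (trans (cong 𝟙 (homᵇ-insert G φ c)) (𝟙-∧ h′ (adj G (φ parent⁻) c)))
               (Π-punchIn (v T⁻) leaf (λ i → g i (insert leaf c φ i))) ⟩
        (h * 𝟙 (adj G (φ parent⁻) c)) * (g leaf (insert leaf c φ leaf) *
           Π[ v T⁻ ] (λ j → g (punchIn leaf j) (insert leaf c φ (punchIn leaf j))))
          ≡⟨ cong₂ (λ x y → (h * 𝟙 (adj G (φ parent⁻) c)) * (g leaf x * y)) (insert-lookup leaf c φ)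
               (Π-cong (v T⁻) (λ j → cong (g (punchIn leaf j)) (insert-punchIn leaf c φ j))) ⟩
        (h * 𝟙 (adj G (φ parent⁻) c)) * (g leaf c * P)
          ≡⟨ reorder h (𝟙 (adj G (φ parent⁻) c)) (g leaf c) P ⟩
        (h * P) * (adjMat G (φ parent⁻) c * g leaf c)
          ∎
        where
        h′ = isHomᵇ T⁻ G φ
        reorder : ∀ h a x P → (h * a) * (x * P) ≡ (h * P) * (a * x)
        reorder = solve-∀ ℚ-ring

    tʷ-absorb : tʷ T G g ≡ tʷ T⁻ G (absorb G g)
    tʷ-absorb = begin
      (i ^ℚ suc (suc k)) * Σ-maps (suc (suc k)) (v G) summand
        ≡⟨ cong (_*_ (i ^ℚ suc (suc k))) (trans (Σ-maps-insert (suc k) (v G) leaf summand)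
             (trans (ΣL-cong (allMaps (suc k) (v G)) Σ-summand-insert)
               (ΣL-*ˡ (allMaps (suc k) (v G)) N summand⁻))) ⟩
      (i * (i ^ℚ suc k)) * (N * S)
        ≡⟨ lemma i (i ^ℚ suc k) N S ⟩
      (i ^ℚ suc k) * ((N * i) * S)
        ≡⟨ cong (λ x → (i ^ℚ suc k) * (x * S)) (v*inv≡1 G) ⟩
      (i ^ℚ suc k) * (1ℚ * S)
        ≡⟨ cong (_*_ (i ^ℚ suc k)) (*-identityˡ S) ⟩
      tʷ T⁻ G (absorb G g)
        ∎
      where
      open ≡-Reasoning
      i = inv G
      N = fromℕℚ (v G)
      S = Σ-maps (suc k) (v G) summand⁻
      lemma : ∀ i q n s → (i * q) * (n * s) ≡ q * ((n * i) * s)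
      lemma = solve-∀ ℚ-ring

  -- A walk between vertices other than the leaf can only pass through the leaf
  -- as parent → leaf → parent, so that detour can be cut out.
  walk⁻ : ∀ {x y} → Walk T x y →
    ∀ x⁻ y⁻ → punchIn leaf x⁻ ≡ x → punchIn leaf y⁻ ≡ y → Walk T⁻ x⁻ y⁻
  walk⁻ here x⁻ y⁻ refl eq = subst (Walk T⁻ x⁻) (F.punchIn-injective leaf x⁻ y⁻ (sym eq)) here
  walk⁻ (step {w = z} x~z rest) x⁻ y⁻ refl eq with view z
  ... | inj₂ (z⁻ , refl) = step x~z (walk⁻ rest z⁻ y⁻ refl eq)
  ... | inj₁ refl with rest
  ...   | here = ⊥-elim (F.punchInᵢ≢i leaf y⁻ eq)
  ...   | step {w = z′} leaf~z′ rest′ =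
    walk⁻ rest′ x⁻ y⁻ (trans (~leaf⇒parent _ x~z) (sym (only-parent z′ leaf~z′))) eq

  isTree-T⁻ : IsTree T → IsTree T⁻
  isTree-T⁻ (connected , acyclic) =
    (λ x⁻ y⁻ → walk⁻ (connected (punchIn leaf x⁻) (punchIn leaf y⁻)) x⁻ y⁻ refl refl) ,
    (λ n c (c-inj , edges , closing) →
      acyclic n (punchIn leaf ∘ c) ((λ eq → c-inj (F.punchIn-injective leaf _ _ eq)) , edges , closing))

-- Nontrivial trees have leaves

data LastView : ∀ {j} → Fin (suc j) → Set where
  last   : ∀ {j} → LastView (fromℕ j)
  inject : ∀ {j} (r : Fin j) → LastView (inject₁ r)

lastView : ∀ {j} (r : Fin (suc j)) → LastView r
lastView {zero}  zero    = last
lastView {suc j} zero    = inject zero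
lastView {suc j} (suc r) with lastView r
... | last     = last
... | inject r = inject (suc r)

walk⇒neighbour : ∀ {G : Graph} {x y} → Walk G x y → x ≢ y → ∃ λ z → adj G x z ≡ true
walk⇒neighbour here             x≢x = ⊥-elim (x≢x refl)
walk⇒neighbour (step {w = z} e _) _ = z , e

-- Following a longest path: its end is a leaf, since any other neighbour of the
-- end either extends the path or closes a cycle.
module _ (G : Graph) (tree : IsTree G) (nontrivial : ∀ (x : V G) → ∃ λ y → x ≢ y) where

  private
    adj-irrefl : ∀ {x y} → adj G x y ≡ true → x ≢ y
    adj-irrefl {x} x~y refl with trans (sym x~y) (irrefl G x)
    ... | ()

  record Path (j : ℕ) : Set where
    field
      at        : Fin (suc j) → V G
      injective : Injective _≡_ _≡_ at
      edge      : ∀ (i : Fin j) → adj G (at (suc i)) (at (inject₁ i)) ≡ true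
  open Path

  init : ∀ {j} → Path (suc j) → Path j
  init π = record
    { at        = at π ∘ inject₁
    ; injective = F.inject₁-injective ∘ injective π
    ; edge      = edge π ∘ inject₁
    }

  cons : ∀ {j} (π : Path j) x → adj G (at π zero) x ≡ true → (∀ i → at π i ≢ x) → Path (suc j)
  cons π x end~x x∉π = record { at = consF x (at π) ; injective = inj ; edge = edges }
    where
    inj : Injective _≡_ _≡_ (consF x (at π))
    inj {zero}  {zero}  _  = refl
    inj {zero}  {suc i} eq = ⊥-elim (x∉π i (sym eq))
    inj {suc i} {zero}  eq = ⊥-elim (x∉π i eq)
    inj {suc i} {suc j} eq = cong suc (injective π eq)
    edges : ∀ i → adj G (consF x (at π) (suc i)) (consF x (at π) (inject₁ i)) ≡ true
    edges zero    = end~x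
    edges (suc i) = edge π i

  no-chord : ∀ j (π : Path (suc j)) (r : Fin j) → adj G (at π zero) (at π (suc (suc r))) ≡ true → ⊥
  no-chord (suc j) π r chord with lastView r
  ... | last = proj₂ tree j (at π)
    (injective π , (λ i → trans (Graph.sym G _ _) (edge π i)) , trans (Graph.sym G _ _) chord)
  no-chord (suc (suc j)) π .(inject₁ r) chord | inject r = no-chord (suc j) (init π) r chord

  end-isLeaf : ∀ {j} (π : Path j) →
    (∀ x → adj G (at π zero) x ≡ true → ∃ λ i → at π i ≡ x) → LeafOf G
  end-isLeaf {zero} π closed with nontrivial (at π zero)
  ... | y , end≢y with walk⇒neighbour (proj₁ tree (at π zero) y) end≢y
  ... | x , end~x with closed x end~x
  ... | zero , refl = ⊥-elim (adj-irrefl end~x refl)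
  end-isLeaf {suc j} π closed = record
    { leaf = at π zero ; parent = at π (suc zero)
    ; leaf~parent = trans (Graph.sym G _ _) (edge π zero) ; only-parent = only }
    where
    only : ∀ x → adj G (at π zero) x ≡ true → x ≡ at π (suc zero)
    only x end~x with closed x end~x
    ... | zero          , refl = ⊥-elim (adj-irrefl end~x refl)
    ... | suc zero      , refl = refl
    ... | suc (suc r)   , refl = ⊥-elim (no-chord j π r end~x)

  -- fuel bounds how often the path can still grow: it has at most v G vertices
  grow : ∀ fuel j (π : Path j) → v G ℕ.≤ suc j ℕ.+ fuel → LeafOf G
  grow fuel j π bound
    with F.any? (λ x → (adj G (at π zero) x ≟ᵇ true) ×-dec ¬? (F.any? (λ i → at π i F.≟ x)))
  ... | no stuck = end-isLeaf π closed
    where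
    closed : ∀ x → adj G (at π zero) x ≡ true → ∃ λ i → at π i ≡ x
    closed x end~x with F.any? (λ i → at π i F.≟ x)
    ... | yes x∈π = x∈π
    ... | no  x∉π = ⊥-elim (stuck (x , end~x , x∉π))
  grow zero     j π bound | yes (x , end~x , x∉π) =
    ⊥-elim (ℕ.<-irrefl refl
      (ℕ.≤-trans (F.injective⇒≤ (injective (cons π x end~x (λ i → x∉π ∘ (i ,_)))))
        (ℕ.≤-trans bound (ℕ.≤-reflexive (ℕ.+-identityʳ (suc j))))))
  grow (suc fuel) j π bound | yes (x , end~x , x∉π) =
    grow fuel (suc j) (cons π x end~x (λ i → x∉π ∘ (i ,_)))
      (ℕ.≤-trans bound (ℕ.≤-reflexive (ℕ.+-suc (suc j) fuel)))

  leaf-exists : LeafOf G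
  leaf-exists = grow (v G) zero point (ℕ.n≤1+n (v G))
    where
    point : Path zero
    point = record { at = λ _ → zero ; injective = λ { {zero} {zero} _ → refl } ; edge = λ () }

-- Matrices and the cut norm

_·ᵛ_ : ∀ {a b} → Mat a b → (Fin b → ℚ) → Fin a → ℚ
_·ᵛ_ {b = b} M x i = Σ[ b ] (λ j → M i j * x j)

·ᴹ-·ᵛ-assoc : ∀ {a b c} (M : Mat a b) (N : Mat b c) x i →
  ((M ·ᴹ N) ·ᵛ x) i ≡ (M ·ᵛ (N ·ᵛ x)) i
·ᴹ-·ᵛ-assoc {b = b} {c} M N x i = begin
  Σ[ c ] (λ j → Σ[ b ] (λ k → M i k * N k j) * x j)
    ≡⟨ Σ-cong c (λ j → sym (Σ-*ʳ b (x j) (λ k → M i k * N k j))) ⟩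
  Σ[ c ] (λ j → Σ[ b ] (λ k → M i k * N k j * x j))
    ≡⟨ Σ-swap c b (λ j k → M i k * N k j * x j) ⟩
  Σ[ b ] (λ k → Σ[ c ] (λ j → M i k * N k j * x j))
    ≡⟨ Σ-cong b (λ k → trans (Σ-cong c (λ j → *-assoc (M i k) (N k j) (x j)))
         (Σ-*ˡ c (M i k) (λ j → N k j * x j))) ⟩
  Σ[ b ] (λ k → M i k * Σ[ c ] (λ j → N k j * x j))
    ∎
  where open ≡-Reasoning

·ᵛ-*ˡ : ∀ {a b} (M : Mat a b) c x i → (M ·ᵛ (λ j → c * x j)) i ≡ c * (M ·ᵛ x) i
·ᵛ-*ˡ {b = b} M c x i = trans (Σ-cong b (λ j → lemma (M i j) c (x j))) (Σ-*ˡ b c (λ j → M i j * x j))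
  where
  lemma : ∀ m c x → m * (c * x) ≡ c * (m * x)
  lemma = solve-∀ ℚ-ring

·ᵛ-+ : ∀ {a b} (M : Mat a b) x y i → (M ·ᵛ (λ j → x j + y j)) i ≡ (M ·ᵛ x) i + (M ·ᵛ y) i
·ᵛ-+ {b = b} M x y i = trans (Σ-cong b (λ j → *-distribˡ-+ (M i j) (x j) (y j)))
  (Σ-+ b (λ j → M i j * x j) (λ j → M i j * y j))

x*r≤positivePart : ∀ {x} r → InUnit x → (d : Dec (0ℚ ≤ r)) → x * r ≤ (if does d then r else 0ℚ)
x*r≤positivePart {x} r (_ , x≤1) (yes 0≤r) =
  ≤-by-difference ((1ℚ - x) * r) (0≤p*q (p≤q⇒0≤q-p x≤1) 0≤r) (lemma x r)
  where
  lemma : ∀ x r → r - x * r ≡ (1ℚ - x) * r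
  lemma = solve-∀ ℚ-ring
x*r≤positivePart {x} r (0≤x , _) (no r≱0) =
  ≤-by-difference (x * - r) (0≤p*q 0≤x (neg-antimono-≤ (<⇒≤ (≰⇒> r≱0)))) (lemma x r)
  where
  lemma : ∀ x r → 0ℚ - x * r ≡ x * - r
  lemma = solve-∀ ℚ-ring

negativePart≤x*r : ∀ {x} r → InUnit x → (d : Dec (0ℚ ≤ r)) →
  (if not (does d) then r else 0ℚ) ≤ x * r
negativePart≤x*r {x} r (0≤x , _) (yes 0≤r) = 0≤p*q 0≤x 0≤r
negativePart≤x*r {x} r (_ , x≤1) (no r≱0) =
  ≤-by-difference ((1ℚ - x) * - r) (0≤p*q (p≤q⇒0≤q-p x≤1) (neg-antimono-≤ (<⇒≤ (≰⇒> r≱0))))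
    (lemma x r)
  where
  lemma : ∀ x r → x * r - r ≡ (1ℚ - x) * - r
  lemma = solve-∀ ℚ-ring

-- A [0,1]-weighted sum lies between the sum of the negative and of the positive terms.
unitWeighted-bound : ∀ n (r : Fin n → ℚ) K →
  (∀ (S : Fin n → Bool) → ∣ Σ[ n ] (λ i → if S i then r i else 0ℚ) ∣ ≤ K) →
  (x : Fin n → ℚ) → UnitValued x → ∣ Σ[ n ] (λ i → x i * r i) ∣ ≤ K
unitWeighted-bound n r K subsets x x∈[0,1] = -q≤p≤q⇒∣p∣≤q
  (≤-trans (∣p∣≤q⇒-q≤p (subsets (λ i → not (does (0ℚ ≤? r i)))))
    (Σ-mono n (λ i → negativePart≤x*r (r i) (x∈[0,1] i) (0ℚ ≤? r i))))
  (≤-trans (Σ-mono n (λ i → x*r≤positivePart (r i) (x∈[0,1] i) (0ℚ ≤? r i)))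
    (∣p∣≤q⇒p≤q (subsets (λ i → does (0ℚ ≤? r i)))))

cutNorm-bilinear : ∀ {n m} (D : Mat n m) K → CutNormLe D K →
  (x : Fin n → ℚ) (y : Fin m → ℚ) → UnitValued x → UnitValued y →
  ∣ Σ[ n ] (λ i → x i * (D ·ᵛ y) i) ∣ ≤ K
cutNorm-bilinear {n} {m} D K cut x y x∈[0,1] y∈[0,1] =
  unitWeighted-bound n (D ·ᵛ y) K rows x x∈[0,1]
  where
  rows : ∀ (S : Fin n → Bool) → ∣ Σ[ n ] (λ i → if S i then (D ·ᵛ y) i else 0ℚ) ∣ ≤ K
  rows S = subst (λ z → ∣ z ∣ ≤ K) (sym swap) (unitWeighted-bound m colSum K cols y y∈[0,1])
    where
    colSum : Fin m → ℚ
    colSum j = Σ[ n ] (λ i → if S i then D i j else 0ℚ)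
    restrict : ∀ i →
      (if S i then (D ·ᵛ y) i else 0ℚ) ≡ Σ[ m ] (λ j → (if S i then D i j else 0ℚ) * y j)
    restrict i with S i
    ... | true  = refl
    ... | false = sym (trans (Σ-cong m (λ j → *-zeroˡ (y j))) (Σ-zero m))
    swap : Σ[ n ] (λ i → if S i then (D ·ᵛ y) i else 0ℚ) ≡ Σ[ m ] (λ j → y j * colSum j)
    swap = trans (Σ-cong n restrict) (trans (Σ-swap n m (λ i j → (if S i then D i j else 0ℚ) * y j))
      (Σ-cong m (λ j → trans (Σ-*ʳ n (y j) (λ i → if S i then D i j else 0ℚ)) (*-comm (colSum j) (y j)))))
    cols : ∀ (T : Fin m → Bool) → ∣ Σ[ m ] (λ j → if T j then colSum j else 0ℚ) ∣ ≤ K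
    cols T = subst (λ z → ∣ z ∣ ≤ K)
      (sym (trans (Σ-cong m select) (Σ-swap m n (λ j i → if S i ∧ T j then D i j else 0ℚ)))) (cut S T)
      where
      select : ∀ j → (if T j then colSum j else 0ℚ) ≡ Σ[ n ] (λ i → if S i ∧ T j then D i j else 0ℚ)
      select j with T j
      ... | true  = Σ-cong n (λ i → cong (λ b → if b then D i j else 0ℚ) (sym (∧-identityʳ (S i))))
      ... | false =
        sym (trans (Σ-cong n (λ i → cong (λ b → if b then D i j else 0ℚ) (∧-zeroʳ (S i)))) (Σ-zero n))

specNorm⇒cutNorm : ∀ {a b} (D : Mat (suc a) (suc b)) η → 0ℚ ≤ η →
  SpecNormSqLe D (η * η * fromℕℚ (suc a) * fromℕℚ (suc b)) →
  CutNormLe D (η * fromℕℚ (suc a) * fromℕℚ (suc b))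
specNorm⇒cutNorm {a} {b} D η 0≤η spec S T = begin
  ∣ Σ[ suc a ] (λ i → Σ[ suc b ] (λ j → if S i ∧ T j then D i j else 0ℚ)) ∣
    ≡⟨ cong ∣_∣ (Σ-cong (suc a) restrict) ⟩
  ∣ Σ[ suc a ] (λ i → 𝟙 (S i) * y i) ∣
    ≤⟨ ≤-trans (∣Σ∣≤Σ∣∣ (suc a) (λ i → 𝟙 (S i) * y i))
         (Σ-mono (suc a) (λ i → ∣r*p∣≤∣p∣ (y i) (InUnit-𝟙 (S i)))) ⟩
  Y
    ≤⟨ p*p≤q*q⇒p≤q (Σ-nonNeg (suc a) (λ i → 0≤∣p∣ (y i))) 0≤K Y*Y≤K*K ⟩
  K
    ∎
  where
  open ≤-Reasoning
  N = fromℕℚ (suc a)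
  M = fromℕℚ (suc b)
  x : Fin (suc b) → ℚ
  x j = 𝟙 (T j)
  y = D ·ᵛ x
  Y = Σ[ suc a ] (λ i → ∣ y i ∣)
  K = η * N * M
  0≤K : 0ℚ ≤ K
  0≤K = 0≤p*q (0≤p*q 0≤η (0≤fromℕℚ (suc a))) (0≤fromℕℚ (suc b))
  restrict : ∀ i → Σ[ suc b ] (λ j → if S i ∧ T j then D i j else 0ℚ) ≡ 𝟙 (S i) * y i
  restrict i with S i
  ... | true  = trans (Σ-cong (suc b) column) (sym (*-identityˡ (y i)))
    where
    column : ∀ j → (if T j then D i j else 0ℚ) ≡ D i j * x j
    column j with T j
    ... | true  = sym (*-identityʳ (D i j))
    ... | false = sym (*-zeroʳ (D i j))
  ... | false = trans (Σ-zero (suc b)) (sym (*-zeroˡ (y i)))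
  ‖x‖²≤M : sqNorm (suc b) x ≤ M
  ‖x‖²≤M = ≤-trans (Σ-mono (suc b) (λ j → proj₂ (InUnit-* (InUnit-𝟙 (T j)) (InUnit-𝟙 (T j)))))
    (≤-reflexive (trans (Σ-const (suc b) 1ℚ) (*-identityʳ M)))
  Y*Y≤K*K : Y * Y ≤ K * K
  Y*Y≤K*K = begin
    Y * Y
      ≤⟨ Σ²≤n*Σ-squares a (λ i → ∣ y i ∣) ⟩
    N * Σ[ suc a ] (λ i → ∣ y i ∣ * ∣ y i ∣)
      ≡⟨ cong (N *_) (Σ-cong (suc a) (λ i → ∣p∣*∣p∣≡p*p (y i))) ⟩
    N * sqNorm (suc a) y
      ≤⟨ *-monoˡ-≤-0≤ (0≤fromℕℚ (suc a)) (≤-trans (spec x)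
           (*-monoˡ-≤-0≤ (0≤p*q (0≤p*q (0≤p*p η) (0≤fromℕℚ (suc a))) (0≤fromℕℚ (suc b)))
             ‖x‖²≤M)) ⟩
    N * (η * η * N * M * M)
      ≡⟨ lemma η N M ⟩
    K * K
      ∎
    where
    lemma : ∀ η N M → N * (η * η * N * M * M) ≡ η * N * M * (η * N * M)
    lemma = solve-∀ ℚ-ring

-- Overlays

𝔼[_] : ∀ {n m} → Mat n m → (Fin n × Fin m → ℚ) → ℚ
𝔼[_] {n} {m} X f = Σ[ n ] (λ u → Σ[ m ] (λ w → X u w * f (u , w)))

cost : ∀ {n m} → Mat n m → (Fin n → ℚ) → (Fin m → ℚ) → ℚ
cost X g h = 𝔼[ X ] (λ (u , w) → ∣ g u - h w ∣)

_ᵀ : ∀ {n m} → Mat n m → Mat m n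
(X ᵀ) w u = X u w

𝔼[ᵀ] : ∀ {n m} (X : Mat n m) f → 𝔼[ X ᵀ ] f ≡ 𝔼[ X ] (λ (u , w) → f (w , u))
𝔼[ᵀ] {n} {m} X f = Σ-swap m n (λ w u → X u w * f (w , u))

cost-ᵀ : ∀ {n m} (X : Mat n m) g h → cost (X ᵀ) h g ≡ cost X g h
cost-ᵀ {n} {m} X g h = trans (𝔼[ᵀ] X _)
  (Σ-cong n (λ u → Σ-cong m (λ w → cong (X u w *_) (∣p-q∣≡∣q-p∣ (h w) (g u)))))

module Overlay {G H : Graph} {X : Mat (v G) (v H)} (ov : IsOverlay G H X) where

  private
    n = v G
    m = v H
    X≥0  = proj₁ ov
    rows = proj₁ (proj₂ ov)
    cols = proj₂ (proj₂ ov)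

  𝔼-fst : ∀ f → 𝔼[ X ] (λ (u , _) → f u) ≡ inv G * Σ[ n ] f
  𝔼-fst f = trans (Σ-cong n row) (Σ-*ˡ n (inv G) f)
    where
    row : ∀ u → Σ[ m ] (λ w → X u w * f u) ≡ inv G * f u
    row u = trans (Σ-*ʳ m (f u) (X u)) (cong (_* f u) (rows u))

  𝔼-snd : ∀ h → 𝔼[ X ] (λ (_ , w) → h w) ≡ inv H * Σ[ m ] h
  𝔼-snd h = trans (Σ-swap n m (λ u w → X u w * h w)) (trans (Σ-cong m col) (Σ-*ˡ m (inv H) h))
    where
    col : ∀ w → Σ[ n ] (λ u → X u w * h w) ≡ inv H * h w
    col w = trans (Σ-*ʳ n (h w) (λ u → X u w)) (cong (_* h w) (cols w))

  𝔼-+ : ∀ f g → 𝔼[ X ] (λ i → f i + g i) ≡ 𝔼[ X ] f + 𝔼[ X ] g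
  𝔼-+ f g = trans (Σ-cong n row) (Σ-+ n (λ u → Σ[ m ] (λ w → X u w * f (u , w)))
                                        (λ u → Σ[ m ] (λ w → X u w * g (u , w))))
    where
    row : ∀ u → Σ[ m ] (λ w → X u w * (f (u , w) + g (u , w)))
              ≡ Σ[ m ] (λ w → X u w * f (u , w)) + Σ[ m ] (λ w → X u w * g (u , w))
    row u = trans (Σ-cong m (λ w → *-distribˡ-+ (X u w) (f (u , w)) (g (u , w))))
      (Σ-+ m (λ w → X u w * f (u , w)) (λ w → X u w * g (u , w)))

  𝔼-* : ∀ c f → 𝔼[ X ] (λ i → c * f i) ≡ c * 𝔼[ X ] f
  𝔼-* c f = trans (Σ-cong n row) (Σ-*ˡ n c (λ u → Σ[ m ] (λ w → X u w * f (u , w))))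
    where
    x*[c*y]≡c*[x*y] : ∀ x c y → x * (c * y) ≡ c * (x * y)
    x*[c*y]≡c*[x*y] = solve-∀ ℚ-ring
    row : ∀ u → Σ[ m ] (λ w → X u w * (c * f (u , w))) ≡ c * Σ[ m ] (λ w → X u w * f (u , w))
    row u = trans (Σ-cong m (λ w → x*[c*y]≡c*[x*y] (X u w) c (f (u , w))))
      (Σ-*ˡ m c (λ w → X u w * f (u , w)))

  𝔼-isMean : IsMean 𝔼[ X ]
  𝔼-isMean = record
    { cong-𝔼 = λ f≡g → Σ-cong n (λ u → Σ-cong m (λ w → cong (X u w *_) (f≡g (u , w))))
    ; nonNeg = λ 0≤f → Σ-nonNeg n (λ u → Σ-nonNeg m (λ w → 0≤p*q (X≥0 u w) (0≤f (u , w))))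
    ; +-homo = 𝔼-+
    ; *-homo = 𝔼-*
    ; 1-homo = trans (𝔼-fst (λ _ → 1ℚ))
                 (trans (cong (inv G *_) (trans (Σ-const n 1ℚ) (*-identityʳ (fromℕℚ n))))
                   (trans (*-comm (inv G) (fromℕℚ n)) (v*inv≡1 G)))
    }

  private
    open module 𝔼 = IsMean 𝔼-isMean

  isOverlay-ᵀ : IsOverlay H G (X ᵀ)
  isOverlay-ᵀ = (λ w u → X≥0 u w) , cols , rows

  diffMat-ᵀ : ∀ w u → diffMat H G (X ᵀ) w u ≡ - diffMat G H X u w
  diffMat-ᵀ w u = trans (cong₂ (λ p q → fromℕℚ n * p - fromℕℚ m * q)
    (Σ-cong m (λ j → trans (cong (λ b → 𝟙 b * X u j) (Graph.sym H w j)) (*-comm (adjMat H j w) (X u j))))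
    (Σ-cong n (λ k → trans (cong (λ b → X k w * 𝟙 b) (Graph.sym G k u)) (*-comm (X k w) (adjMat G u k)))))
    (lemma (fromℕℚ n) (fromℕℚ m) _ _)
    where
    lemma : ∀ N M p q → N * p - M * q ≡ - (M * q - N * p)
    lemma = solve-∀ ℚ-ring

  cutNorm-ᵀ : ∀ e → CutNormLe (diffMat G H X) (e * fromℕℚ n * fromℕℚ m) →
    CutNormLe (diffMat H G (X ᵀ)) (e * fromℕℚ m * fromℕℚ n)
  cutNorm-ᵀ e cut T S = subst₂ _≤_ (sym same-abs) (lemma e (fromℕℚ n) (fromℕℚ m)) (cut S T)
    where
    lemma : ∀ e N M → e * N * M ≡ e * M * N
    lemma = solve-∀ ℚ-ring
    f : Fin n → Fin m → ℚ
    f u w = if S u ∧ T w then diffMat G H X u w else 0ℚ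
    pointwise : ∀ w u → (if T w ∧ S u then diffMat H G (X ᵀ) w u else 0ℚ) ≡ - f u w
    pointwise w u with T w | S u
    ... | true  | true  = diffMat-ᵀ w u
    ... | true  | false = refl
    ... | false | true  = refl
    ... | false | false = refl
    same-abs : ∣ Σ[ m ] (λ w → Σ[ n ] (λ u → if T w ∧ S u then diffMat H G (X ᵀ) w u else 0ℚ)) ∣
             ≡ ∣ Σ[ n ] (λ u → Σ[ m ] (f u)) ∣
    same-abs = trans (cong ∣_∣
      (trans (Σ-cong m (λ w → trans (Σ-cong n (pointwise w)) (Σ-neg n (λ u → f u w))))
      (trans (Σ-neg m (λ w → Σ[ n ] (λ u → f u w))) (cong -_ (Σ-swap m n (λ w u → f u w))))))
      (∣-p∣≡∣p∣ _)

  ∣mean-mean∣≤cost : ∀ g h → ∣ inv G * Σ[ n ] g - inv H * Σ[ m ] h ∣ ≤ cost X g h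
  ∣mean-mean∣≤cost g h = subst (λ z → ∣ z ∣ ≤ cost X g h)
    (trans (minus-homo (λ (u , _) → g u) (λ (_ , w) → h w)) (cong₂ _-_ (𝔼-fst g) (𝔼-snd h)))
    (∣𝔼∣≤𝔼∣∣ (λ (u , w) → g u - h w))

  cost-* : ∀ {g g′ h h′} → UnitValued g′ → UnitValued h →
    cost X (λ u → g u * g′ u) (λ w → h w * h′ w) ≤ cost X g h + cost X g′ h′
  cost-* {g} {g′} {h} {h′} g′∈[0,1] h∈[0,1] = ≤-trans
    (mono (λ (u , w) → ∣pr-qt∣≤ (g u) (h w) (g′ u) (h′ w) (g′∈[0,1] u) (h∈[0,1] w)))
    (≤-reflexive (+-homo (λ (u , w) → ∣ g u - h w ∣) (λ (u , w) → ∣ g′ u - h′ w ∣)))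
    where
    lemma : ∀ p q r t → r * (p - q) + q * (r - t) ≡ p * r - q * t
    lemma = solve-∀ ℚ-ring
    ∣pr-qt∣≤ : ∀ p q r t → InUnit r → InUnit q → ∣ p * r - q * t ∣ ≤ ∣ p - q ∣ + ∣ r - t ∣
    ∣pr-qt∣≤ p q r t r∈[0,1] q∈[0,1] =
      subst (_≤ ∣ p - q ∣ + ∣ r - t ∣) (cong ∣_∣ (lemma p q r t))
      (≤-trans (∣p+q∣≤∣p∣+∣q∣ (r * (p - q)) (q * (r - t)))
        (+-mono-≤ (∣r*p∣≤∣p∣ (p - q) r∈[0,1]) (∣r*p∣≤∣p∣ (r - t) q∈[0,1])))

module CrossTerm {G H : Graph} {X : Mat (v G) (v H)} (ov : IsOverlay G H X)
  (e : ℚ) (cut : CutNormLe (diffMat G H X) (e * fromℕℚ (v G) * fromℕℚ (v H)))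
  (g : V G → ℚ) (h : V H → ℚ) (g∈[0,1] : UnitValued g) (h∈[0,1] : UnitValued h) where

  private
    n = v G
    m = v H
    N = fromℕℚ n
    M = fromℕℚ m
    A = adjMat G
    B = adjMat H
    D = diffMat G H X

  a = adjMean G g
  b = adjMean H h

  err : V G → ℚ
  err k = (X ·ᵛ h) k - inv G * g k

  X·B : ∀ u j → (X ·ᴹ B) u j ≡ inv G * (M * (A ·ᴹ X) u j - D u j)
  X·B u j = begin
    (X ·ᴹ B) u j                              ≡⟨ *-identityˡ ((X ·ᴹ B) u j) ⟨
    1ℚ * (X ·ᴹ B) u j                         ≡⟨ cong (_* (X ·ᴹ B) u j)
                                                     (trans (*-comm (inv G) N) (v*inv≡1 G)) ⟨
    (inv G * N) * (X ·ᴹ B) u j                ≡⟨ lemma (inv G) N M ((A ·ᴹ X) u j) ((X ·ᴹ B) u j) ⟨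
    inv G * (M * (A ·ᴹ X) u j - D u j)        ∎
    where
    open ≡-Reasoning
    lemma : ∀ i N M p q → i * (M * p - (M * p - N * q)) ≡ (i * N) * q
    lemma = solve-∀ ℚ-ring

  A·X·h : ∀ u → ((A ·ᴹ X) ·ᵛ h) u ≡ (A ·ᵛ err) u + a u
  A·X·h u = begin
    ((A ·ᴹ X) ·ᵛ h) u                              ≡⟨ ·ᴹ-·ᵛ-assoc A X h u ⟩
    (A ·ᵛ (X ·ᵛ h)) u                              ≡⟨ Σ-cong n (λ k → cong (A u k *_) (split k)) ⟩
    (A ·ᵛ (λ k → err k + inv G * g k)) u           ≡⟨ ·ᵛ-+ A err (λ k → inv G * g k) u ⟩
    (A ·ᵛ err) u + (A ·ᵛ (λ k → inv G * g k)) u    ≡⟨ cong (_+_ ((A ·ᵛ err) u))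
                                                        (·ᵛ-*ˡ A (inv G) g u) ⟩
    (A ·ᵛ err) u + a u                             ∎
    where
    open ≡-Reasoning
    lemma : ∀ x y → x - y + y ≡ x
    lemma = solve-∀ ℚ-ring
    split : ∀ k → (X ·ᵛ h) k ≡ err k + inv G * g k
    split k = sym (lemma ((X ·ᵛ h) k) (inv G * g k))

  X·b : ∀ u → (X ·ᵛ b) u ≡ inv G * ((A ·ᵛ err) u + a u) - (inv G * inv H) * (D ·ᵛ h) u
  X·b u = begin
    (X ·ᵛ b) u
      ≡⟨ ·ᵛ-*ˡ X (inv H) (B ·ᵛ h) u ⟩
    inv H * (X ·ᵛ (B ·ᵛ h)) u
      ≡⟨ cong (inv H *_) (sym (·ᴹ-·ᵛ-assoc X B h u)) ⟩
    inv H * ((X ·ᴹ B) ·ᵛ h) u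
      ≡⟨ cong (inv H *_) (Σ-cong m (λ j → cong (_* h j) (X·B u j))) ⟩
    inv H * Σ[ m ] (λ j → inv G * (M * (A ·ᴹ X) u j - D u j) * h j)
      ≡⟨ cong (inv H *_) (linear (inv G) M (λ j → (A ·ᴹ X) u j) (λ j → D u j)) ⟩
    inv H * (inv G * (M * ((A ·ᴹ X) ·ᵛ h) u - (D ·ᵛ h) u))
      ≡⟨ cong (λ z → inv H * (inv G * (M * z - (D ·ᵛ h) u))) (A·X·h u) ⟩
    inv H * (inv G * (M * ((A ·ᵛ err) u + a u) - (D ·ᵛ h) u))
      ≡⟨ collect (inv H) (inv G) M ((A ·ᵛ err) u + a u) ((D ·ᵛ h) u) ⟩
    (M * inv H) * (inv G * ((A ·ᵛ err) u + a u)) - (inv G * inv H) * (D ·ᵛ h) u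
      ≡⟨ cong (λ z → z * (inv G * ((A ·ᵛ err) u + a u)) - (inv G * inv H) * (D ·ᵛ h) u) (v*inv≡1 H) ⟩
    1ℚ * (inv G * ((A ·ᵛ err) u + a u)) - (inv G * inv H) * (D ·ᵛ h) u
      ≡⟨ cong (_- (inv G * inv H) * (D ·ᵛ h) u) (*-identityˡ (inv G * ((A ·ᵛ err) u + a u))) ⟩
    inv G * ((A ·ᵛ err) u + a u) - (inv G * inv H) * (D ·ᵛ h) u
      ∎
    where
    open ≡-Reasoning
    expand : ∀ i M p d x → i * (M * p - d) * x ≡ i * (M * (p * x) - d * x)
    expand = solve-∀ ℚ-ring
    collect : ∀ j i M z r → j * (i * (M * z - r)) ≡ (M * j) * (i * z) - (i * j) * r
    collect = solve-∀ ℚ-ring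
    linear : ∀ i M (p d : Fin m → ℚ) → Σ[ m ] (λ j → i * (M * p j - d j) * h j)
                                     ≡ i * (M * Σ[ m ] (λ j → p j * h j) - Σ[ m ] (λ j → d j * h j))
    linear i M p d = begin
      Σ[ m ] (λ j → i * (M * p j - d j) * h j)
        ≡⟨ Σ-cong m (λ j → expand i M (p j) (d j) (h j)) ⟩
      Σ[ m ] (λ j → i * (M * (p j * h j) - d j * h j))
        ≡⟨ Σ-*ˡ m i (λ j → M * (p j * h j) - d j * h j) ⟩
      i * Σ[ m ] (λ j → M * (p j * h j) - d j * h j)
        ≡⟨ cong (i *_) (Σ-- m (λ j → M * (p j * h j)) (λ j → d j * h j)) ⟩
      i * (Σ[ m ] (λ j → M * (p j * h j)) - Σ[ m ] (λ j → d j * h j))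
        ≡⟨ cong (λ z → i * (z - Σ[ m ] (λ j → d j * h j))) (Σ-*ˡ m M (λ j → p j * h j)) ⟩
      i * (M * Σ[ m ] (λ j → p j * h j) - Σ[ m ] (λ j → d j * h j))
        ∎

  Y₁ = Σ[ n ] (λ u → a u * (A ·ᵛ err) u)
  Y₂ = Σ[ n ] (λ u → a u * (D ·ᵛ h) u)
  P  = inv G * Σ[ n ] (λ u → a u * a u)

  cross : 𝔼[ X ] (λ (u , w) → a u * b w) ≡ P + (inv G * Y₁ - (inv G * inv H) * Y₂)
  cross = begin
    𝔼[ X ] (λ (u , w) → a u * b w)
      ≡⟨ Σ-cong n (λ u → trans (Σ-cong m (λ w → lemma₁ (X u w) (a u) (b w)))
           (Σ-*ˡ m (a u) (λ w → X u w * b w))) ⟩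
    Σ[ n ] (λ u → a u * (X ·ᵛ b) u)
      ≡⟨ Σ-cong n (λ u → trans (cong (a u *_) (X·b u)) (lemma₂ (a u) (inv G) (r₁ u) c (r₂ u))) ⟩
    Σ[ n ] (λ u → inv G * (a u * a u) + (inv G * (a u * r₁ u) - c * (a u * r₂ u)))
      ≡⟨ Σ-+ n (λ u → inv G * (a u * a u)) (λ u → inv G * (a u * r₁ u) - c * (a u * r₂ u)) ⟩
    Σ[ n ] (λ u → inv G * (a u * a u)) + Σ[ n ] (λ u → inv G * (a u * r₁ u) - c * (a u * r₂ u))
      ≡⟨ cong₂ _+_ (Σ-*ˡ n (inv G) (λ u → a u * a u))
           (trans (Σ-- n (λ u → inv G * (a u * r₁ u)) (λ u → c * (a u * r₂ u)))
             (cong₂ _-_ (Σ-*ˡ n (inv G) (λ u → a u * r₁ u)) (Σ-*ˡ n c (λ u → a u * r₂ u)))) ⟩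
    P + (inv G * Y₁ - c * Y₂)
      ∎
    where
    open ≡-Reasoning
    c = inv G * inv H
    r₁ = A ·ᵛ err
    r₂ = D ·ᵛ h
    lemma₁ : ∀ x p q → x * (p * q) ≡ p * (x * q)
    lemma₁ = solve-∀ ℚ-ring
    lemma₂ : ∀ p i r c s → p * (i * (r + p) - c * s) ≡ i * (p * p) + (i * (p * r) - c * (p * s))
    lemma₂ = solve-∀ ℚ-ring

  ∣err∣≤ : ∀ k → ∣ err k ∣ ≤ Σ[ m ] (λ j → X k j * ∣ g k - h j ∣)
  ∣err∣≤ k = begin
    ∣ err k ∣
      ≡⟨ cong ∣_∣ (trans (cong (λ z → (X ·ᵛ h) k - z) (sym row))
           (trans (sym (Σ-- m (λ j → X k j * h j) (λ j → X k j * g k)))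
             (Σ-cong m (λ j → lemma (X k j) (h j) (g k))))) ⟩
    ∣ Σ[ m ] (λ j → X k j * (h j - g k)) ∣
      ≤⟨ ∣Σ∣≤Σ∣∣ m (λ j → X k j * (h j - g k)) ⟩
    Σ[ m ] (λ j → ∣ X k j * (h j - g k) ∣)
      ≡⟨ Σ-cong m (λ j → trans (∣p*q∣≡∣p∣*∣q∣ (X k j) (h j - g k))
           (cong₂ _*_ (0≤p⇒∣p∣≡p (proj₁ ov k j)) (∣p-q∣≡∣q-p∣ (h j) (g k)))) ⟩
    Σ[ m ] (λ j → X k j * ∣ g k - h j ∣)
      ∎
    where
    open ≤-Reasoning
    row : Σ[ m ] (λ j → X k j * g k) ≡ inv G * g k
    row = trans (Σ-*ʳ m (g k) (X k)) (cong (_* g k) (proj₁ (proj₂ ov) k))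
    lemma : ∀ x p q → x * p - x * q ≡ x * (p - q)
    lemma = solve-∀ ℚ-ring

  Y₁-bound : inv G * ∣ Y₁ ∣ ≤ cost X g h
  Y₁-bound = begin
    inv G * ∣ Y₁ ∣
      ≤⟨ *-monoˡ-≤-0≤ (0≤inv G)
           (≤-trans (∣Σ∣≤Σ∣∣ n (λ u → a u * (A ·ᵛ err) u)) (Σ-mono n ∣a*A·err∣≤)) ⟩
    inv G * Σ[ n ] (λ _ → E)
      ≡⟨ trans (cong (inv G *_) (Σ-const n E)) (trans (sym (*-assoc (inv G) N E))
           (trans (cong (_* E) (trans (*-comm (inv G) N) (v*inv≡1 G))) (*-identityˡ E))) ⟩
    E
      ≤⟨ Σ-mono n ∣err∣≤ ⟩
    cost X g h
      ∎
    where
    open ≤-Reasoning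
    E = Σ[ n ] (λ k → ∣ err k ∣)
    ∣a*A·err∣≤ : ∀ u → ∣ a u * (A ·ᵛ err) u ∣ ≤ E
    ∣a*A·err∣≤ u = ≤-trans (∣r*p∣≤∣p∣ ((A ·ᵛ err) u) (adjMean-unit G g∈[0,1] u))
      (≤-trans (∣Σ∣≤Σ∣∣ n (λ k → A u k * err k))
        (Σ-mono n (λ k → ∣r*p∣≤∣p∣ (err k) (InUnit-adjMat G u k))))

  Y₂-bound : (inv G * inv H) * Y₂ ≤ e
  Y₂-bound = begin
    (inv G * inv H) * Y₂
      ≤⟨ *-monoˡ-≤-0≤ (0≤p*q (0≤inv G) (0≤inv H)) (≤-trans (p≤∣p∣ Y₂)
           (cutNorm-bilinear D (e * N * M) cut a h (adjMean-unit G g∈[0,1]) h∈[0,1])) ⟩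
    (inv G * inv H) * (e * N * M)
      ≡⟨ lemma (inv G) (inv H) e N M ⟩
    e * (N * inv G) * (M * inv H)
      ≡⟨ cong₂ (λ p q → e * p * q) (v*inv≡1 G) (v*inv≡1 H) ⟩
    e * 1ℚ * 1ℚ
      ≡⟨ trans (*-identityʳ (e * 1ℚ)) (*-identityʳ e) ⟩
    e
      ∎
    where
    open ≤-Reasoning
    lemma : ∀ i j e N M → (i * j) * (e * N * M) ≡ e * (N * i) * (M * j)
    lemma = solve-∀ ℚ-ring

  cross-lower : P - (cost X g h + e) ≤ 𝔼[ X ] (λ (u , w) → a u * b w)
  cross-lower = begin
    P - (cost X g h + e)
      ≡⟨ cong (_+_ P) (neg-distrib-+ (cost X g h) e) ⟩
    P + (- cost X g h + - e)
      ≤⟨ +-monoʳ-≤ P (+-mono-≤ Y₁-lower (neg-antimono-≤ Y₂-bound)) ⟩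
    P + (inv G * Y₁ - (inv G * inv H) * Y₂)
      ≡⟨ cross ⟨
    𝔼[ X ] (λ (u , w) → a u * b w)
      ∎
    where
    open ≤-Reasoning
    Y₁-lower : - cost X g h ≤ inv G * Y₁
    Y₁-lower = begin
      - cost X g h          ≤⟨ neg-antimono-≤ Y₁-bound ⟩
      - (inv G * ∣ Y₁ ∣)     ≡⟨ neg-distribʳ-* (inv G) ∣ Y₁ ∣ ⟩
      inv G * - ∣ Y₁ ∣       ≤⟨ *-monoˡ-≤-0≤ (0≤inv G) (∣p∣≤q⇒-q≤p ≤-refl) ⟩
      inv G * Y₁            ∎

module _ {G H : Graph} {X : Mat (v G) (v H)} (ov : IsOverlay G H X)
  (e : ℚ) (cut : CutNormLe (diffMat G H X) (e * fromℕℚ (v G) * fromℕℚ (v H)))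
  {g : V G → ℚ} {h : V H → ℚ} (g∈[0,1] : UnitValued g) (h∈[0,1] : UnitValued h) where

  private
    n = v G
    m = v H
    open Overlay {G} {H} {X} ov
    module 𝔼 = IsMean 𝔼-isMean
    module C  = CrossTerm {G} {H} {X} ov e cut g h g∈[0,1] h∈[0,1]
    module Cᵀ = CrossTerm {H} {G} {X ᵀ} isOverlay-ᵀ e (cutNorm-ᵀ e cut) h g h∈[0,1] g∈[0,1]
    a = adjMean G g
    b = adjMean H h
    L = 𝔼[ X ] (λ (u , w) → a u * b w)
    δ = cost X g h + e
    Q = inv H * Σ[ m ] (λ w → b w * b w)

  cross-lowerᵀ : Q - δ ≤ L
  cross-lowerᵀ = subst₂ (λ d z → Q - (d + e) ≤ z) (cost-ᵀ X g h)
    (trans (𝔼[ᵀ] X (λ (w , u) → b w * a u)) (𝔼.cong-𝔼 (λ (u , w) → *-comm (b w) (a u))))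
    Cᵀ.cross-lower

  squared-gap : 𝔼[ X ] (λ (u , w) → (a u - b w) * (a u - b w)) ≡ C.P + Q - (L + L)
  squared-gap = begin
    𝔼[ X ] (λ (u , w) → (a u - b w) * (a u - b w))
      ≡⟨ 𝔼.cong-𝔼 (λ (u , w) → expand (a u) (b w)) ⟩
    𝔼[ X ] (λ (u , w) → a u * a u + b w * b w - (a u * b w + a u * b w))
      ≡⟨ 𝔼.minus-homo (λ (u , w) → a u * a u + b w * b w) (λ (u , w) → a u * b w + a u * b w) ⟩
    𝔼[ X ] (λ (u , w) → a u * a u + b w * b w) - 𝔼[ X ] (λ (u , w) → a u * b w + a u * b w)
      ≡⟨ cong₂ _-_ (trans (𝔼.+-homo (λ (u , _) → a u * a u) (λ (_ , w) → b w * b w))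
                     (cong₂ _+_ (𝔼-fst (λ u → a u * a u)) (𝔼-snd (λ w → b w * b w))))
                   (𝔼.+-homo (λ (u , w) → a u * b w) (λ (u , w) → a u * b w)) ⟩
    C.P + Q - (L + L)
      ∎
    where
    open ≡-Reasoning
    expand : ∀ p q → (p - q) * (p - q) ≡ p * p + q * q - (p * q + p * q)
    expand = solve-∀ ℚ-ring

  cost-adjMean² : cost X a b * cost X a b ≤ δ + δ
  cost-adjMean² = begin
    cost X a b * cost X a b
      ≤⟨ 𝔼.𝔼²≤𝔼-square (λ (u , w) → ∣ a u - b w ∣) ⟩
    𝔼[ X ] (λ (u , w) → ∣ a u - b w ∣ * ∣ a u - b w ∣)
      ≡⟨ 𝔼.cong-𝔼 (λ (u , w) → ∣p∣*∣p∣≡p*p (a u - b w)) ⟩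
    𝔼[ X ] (λ (u , w) → (a u - b w) * (a u - b w))
      ≡⟨ squared-gap ⟩
    C.P + Q - (L + L)
      ≤⟨ ≤-by-difference ((L - (C.P - δ)) + (L - (Q - δ)))
           (0≤p+q (p≤q⇒0≤q-p C.cross-lower) (p≤q⇒0≤q-p cross-lowerᵀ)) (lemma δ C.P Q L) ⟩
    δ + δ
      ∎
    where
    open ≤-Reasoning
    lemma : ∀ d p q L → d + d - (p + q - (L + L)) ≡ (L - (p - d)) + (L - (q - d))
    lemma = solve-∀ ℚ-ring

-- Induction over trees

atPoint-unit : ∀ {k} (p j : Fin k) {c} → InUnit c → InUnit (atPoint p c j)
atPoint-unit p j c∈[0,1] with does (j F.≟ p)
... | true  = c∈[0,1]
... | false = InUnit-1

cost-1 : ∀ {n m} (X : Mat n m) → cost X (λ _ → 1ℚ) (λ _ → 1ℚ) ≡ 0ℚ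
cost-1 {n} {m} X = trans (Σ-cong n (λ u → trans (Σ-cong m (λ w → *-zeroʳ (X u w))) (Σ-zero m))) (Σ-zero n)

cost-atPoint : ∀ {n m} (X : Mat n m) {k} (p j : Fin k) {f f′ q} → 0ℚ ≤ q → cost X f f′ ≤ q →
  cost X (λ u → atPoint p (f u) j) (λ w → atPoint p (f′ w) j) ≤ q
cost-atPoint {n} {m} X p j 0≤q cost≤q with does (j F.≟ p)
... | true  = cost≤q
... | false = subst (_≤ _) (sym (cost-1 X)) 0≤q

Controls : Graph → ℚ → ℚ → Set
Controls T ε δ = ∀ G H (X : Mat (v G) (v H)) → IsOverlay G H X →
  ∀ e → CutNormLe (diffMat G H X) (e * fromℕℚ (v G) * fromℕℚ (v H)) → e ≤ δ →
  ∀ g h → (∀ i → UnitValued (g i)) → (∀ i → UnitValued (h i)) →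
  (∀ i → cost X (g i) (h i) ≤ δ) → ∣ tʷ T G g - tʷ T H h ∣ ≤ ε

tʷ-K₁ : ∀ a s ir (G : Graph) g → tʷ (graphOn 0 a s ir) G g ≡ inv G * Σ[ v G ] (g zero)
tʷ-K₁ a s ir G g = cong₂ _*_ (*-identityʳ (inv G))
  (trans (Σ-maps-suc 0 (v G) summand) (trans (+-identityʳ _) (Σ-cong (v G) one-vertex)))
  where
  K₁ = graphOn 0 a s ir
  summand : (Fin 1 → V G) → ℚ
  summand φ = 𝟙 (isHomᵇ K₁ G φ) * Π[ 1 ] (λ i → g i (φ i))
  all-hom : ∀ φ → isHomᵇ K₁ G φ ≡ true
  all-hom φ = isHomᵇ-complete K₁ G φ
    λ { zero zero loop → ⊥-elim (true≢false (trans (sym loop) (ir zero))) }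
    where
    true≢false : true ≢ false
    true≢false ()
  one-vertex : ∀ c → summand (consF c (λ ())) ≡ g zero c
  one-vertex c rewrite all-hom (consF c (λ ())) = trans (*-identityˡ _) (*-identityʳ (g zero c))

controls-K₁ : ∀ a s ir ε → Controls (graphOn 0 a s ir) ε ε
controls-K₁ a s ir ε G H X ov e cut e≤ε g h _ _ cost≤ε =
  subst₂ (λ p q → ∣ p - q ∣ ≤ ε) (sym (tʷ-K₁ a s ir G g)) (sym (tʷ-K₁ a s ir H h))
    (≤-trans (Overlay.∣mean-mean∣≤cost {G} {H} {X} ov (g zero) (h zero)) (cost≤ε zero))

module _ {k} (a : Fin (suc (suc k)) → Fin (suc (suc k)) → Bool)
  (a-sym : ∀ x y → a x y ≡ a y x) (a-irrefl : ∀ x → a x x ≡ false)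
  (L : LeafOf (graphOn (suc k) a a-sym a-irrefl)) where

  open LeafOf L
  open LeafRemoval a a-sym a-irrefl L

  -- If the weights cost at most δ, then cost(adjMean g, adjMean h)² ≤ 4δ ≤ q², so absorbing
  -- the leaf into its parent's weight adds at most q to the cost at every vertex.
  controls-absorb : ∀ ε q δ → 0ℚ ≤ q → δ ≤ q → (δ + δ) + (δ + δ) ≤ q * q →
    Controls T⁻ ε (q + q) → Controls T ε δ
  controls-absorb ε q δ 0≤q δ≤q 4δ≤q² controls⁻ G H X ov e cut e≤δ g h g∈[0,1] h∈[0,1] cost≤δ =
    subst₂ (λ x y → ∣ x - y ∣ ≤ ε) (sym (tʷ-absorb G g)) (sym (tʷ-absorb H h))
      (controls⁻ G H X ov e cut (≤-trans e≤δ δ≤2q) (absorb G g) (absorb H h)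
        (absorbed-unit G g∈[0,1]) (absorbed-unit H h∈[0,1]) absorbed-cost)
    where
    open Overlay {G} {H} {X} ov using (𝔼-isMean; cost-*)
    δ≤2q : δ ≤ q + q
    δ≤2q = ≤-trans δ≤q (subst (_≤ q + q) (+-identityʳ q) (+-monoʳ-≤ q 0≤q))
    weight : ∀ G → (V T → V G → ℚ) → V T⁻ → V G → ℚ
    weight G f j z = atPoint parent⁻ (adjMean G (f leaf) z) j
    weight-unit : ∀ G {f : V T → V G → ℚ} → (∀ i → UnitValued (f i)) →
      ∀ j → UnitValued (weight G f j)
    weight-unit G f∈[0,1] j z = atPoint-unit parent⁻ j (adjMean-unit G (f∈[0,1] leaf) z)
    absorbed-unit : ∀ G {f : V T → V G → ℚ} → (∀ i → UnitValued (f i)) →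
      ∀ j → UnitValued (absorb G f j)
    absorbed-unit G f∈[0,1] j z = InUnit-* (f∈[0,1] (punchIn leaf j) z) (weight-unit G f∈[0,1] j z)
    adjMean-cost : cost X (adjMean G (g leaf)) (adjMean H (h leaf)) ≤ q
    adjMean-cost = p*p≤q*q⇒p≤q
      (IsMean.nonNeg 𝔼-isMean (λ (u , w) → 0≤∣p∣ (adjMean G (g leaf) u - adjMean H (h leaf) w))) 0≤q
      (≤-trans (cost-adjMean² {G} {H} {X} ov e cut (g∈[0,1] leaf) (h∈[0,1] leaf))
        (≤-trans (+-mono-≤ (+-mono-≤ (cost≤δ leaf) e≤δ) (+-mono-≤ (cost≤δ leaf) e≤δ)) 4δ≤q²))
    absorbed-cost : ∀ j → cost X (absorb G g j) (absorb H h j) ≤ q + q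
    absorbed-cost j = ≤-trans
      (cost-* {g (punchIn leaf j)} {weight G g j} {h (punchIn leaf j)} {weight H h j}
        (weight-unit G g∈[0,1] j) (h∈[0,1] (punchIn leaf j)))
      (+-mono-≤ (≤-trans (cost≤δ (punchIn leaf j)) δ≤q)
        (cost-atPoint X parent⁻ j {adjMean G (g leaf)} {adjMean H (h leaf)} 0≤q adjMean-cost))

½ ¼ : ℚ
½ = + 1 / 2
¼ = + 1 / 4

halves : ∀ x → x * ½ + x * ½ ≡ x
halves = solve-∀ ℚ-ring

quarters : ∀ x → x * ¼ + x * ¼ + (x * ¼ + x * ¼) ≡ x
quarters = solve-∀ ℚ-ring

tree-controls : ∀ k a s ir → IsTree (graphOn k a s ir) → ∀ ε → 0ℚ < ε →
  ∃ λ δ → 0ℚ < δ × Controls (graphOn k a s ir) ε δ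
tree-controls zero    a s ir _    ε 0<ε = ε , 0<ε , controls-K₁ a s ir ε
tree-controls (suc k) a s ir tree ε 0<ε =
  δ , 0<δ , controls-absorb a s ir L ε q δ (<⇒≤ 0<q) (p⊓q≤q (q * q * ¼) q) 4δ≤q²
    (subst (Controls T⁻ ε) (sym (halves δ′)) controls⁻)
  where
  nontrivial : ∀ (x : Fin (suc (suc k))) → ∃ λ y → x ≢ y
  nontrivial zero    = suc zero , λ ()
  nontrivial (suc _) = zero , λ ()
  L = leaf-exists (graphOn (suc k) a s ir) tree nontrivial
  open LeafRemoval a s ir L using (T⁻; isTree-T⁻)
  IH = tree-controls k (adj T⁻) (Graph.sym T⁻) (irrefl T⁻) (isTree-T⁻ tree) ε 0<ε
  δ′ = proj₁ IH
  controls⁻ = proj₂ (proj₂ IH)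
  q = δ′ * ½
  0<q : 0ℚ < q
  0<q = 0<p*q (proj₁ (proj₂ IH)) (0<1/suc 1)
  δ = (q * q * ¼) ⊓ q
  0<δ : 0ℚ < δ
  0<δ = 0<p⊓q (0<p*q (0<p*q 0<q 0<q) (0<1/suc 3)) 0<q
  4δ≤q² : (δ + δ) + (δ + δ) ≤ q * q
  4δ≤q² =
    ≤-trans (+-mono-≤ (+-mono-≤ δ≤ δ≤) (+-mono-≤ δ≤ δ≤)) (≤-reflexive (quarters (q * q)))
    where
    δ≤ = p⊓q≤p (q * q * ¼) q

normOK⇒cutNorm : ∀ d {G H X} η → 0ℚ ≤ η → NormOK d G H X η →
  CutNormLe (diffMat G H X) (η * fromℕℚ (v G) * fromℕℚ (v H))
normOK⇒cutNorm cutDist                η _   bound = bound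
normOK⇒cutNorm specDist {G} {H} {X} η 0≤η bound = specNorm⇒cutNorm (diffMat G H X) η 0≤η bound

theorem6 : (d : Dist) (T : Graph) → IsTree T → (ε : ℚ) → 0ℚ < ε →
    Σ ℚ λ η → 0ℚ < η × ((G H : Graph) → DistLe d G H η →
    ∣ t T G - t T H ∣ ≤ ε)
theorem6 d T tree ε 0<ε = η , 0<η , close
  where
  controlled = tree-controls (pn T) (adj T) (Graph.sym T) (irrefl T) tree ε 0<ε
  δ = proj₁ controlled
  0≤δ = <⇒≤ (proj₁ (proj₂ controlled))
  η = δ * ½
  0<η : 0ℚ < η
  0<η = 0<p*q (proj₁ (proj₂ controlled)) (0<1/suc 1)
  η<δ : η < δ
  η<δ = subst₂ _<_ (+-identityˡ η) (halves δ) (+-monoˡ-< η 0<η)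
  close : (G H : Graph) → DistLe d G H η → ∣ t T G - t T H ∣ ≤ ε
  close G H dist = subst₂ (λ x y → ∣ x - y ∣ ≤ ε) (sym (t≡tʷ-1 T G)) (sym (t≡tʷ-1 T H))
    (proj₂ (proj₂ controlled) G H X ov δ (normOK⇒cutNorm d δ 0≤δ bound) ≤-refl
      (λ _ _ → 1ℚ) (λ _ _ → 1ℚ) (λ _ _ → InUnit-1) (λ _ _ → InUnit-1)
      (λ _ → subst (_≤ δ) (sym (cost-1 X)) 0≤δ))
    where
    X = proj₁ (dist δ η<δ)
    ov = proj₁ (proj₂ (dist δ η<δ))
    bound = proj₂ (proj₂ (dist δ η<δ))
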